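{- For every $n\ge1$ and every antichain $A$ of $\mathsf{A}^n$, $\mathrm{LK}(A)=\mathrm{rvac}_{\mathcal{A}}(A)$.
   Context: $\mathsf{A}^n$ is the poset of intervals $[i,j]=\{i,\dots,j\}$, $1\le i\le j\le n$, ordered by inclusion; it is graded of rank $r=n-1$ with $\mathrm{rk}([i,j])=j-i$, and $\mathsf{A}^n_k$ is the set of rank-$k$ elements. An antichain $A=\{[i_1,j_1],\dots,[i_k,j_k]\}$ with $i_1<\dots<i_k$ has $j_1<\dots<j_k$; $\mathrm{LK}(A)=\{[i'_1,j'_1],\dots,[i'_m,j'_m]\}$ with $\{i'_1<\dots<i'_m\}=\{1,\dots,n\}\setminus\{j_1,\dots,j_k\}$ and $\{j'_1<\dots<j'_m\}=\{1,\dots,n\}\setminus\{i_1,\dots,i_k\}$. Antichain toggle: $\tau_p(A)=A\cup\{p\}$ if $p\notin A$ and $A\cup\{p\}$ is an antichain, $A\setminus\{p\}$ if $p\in A$, else $A$. $\boldsymbol{\tau}_k=\prod_{p\in\mathsf{A}^n_k}\tau_p$. Products are compositions, rightmost first. $\mathrm{rvac}_{\mathcal{A}}=(\boldsymbol{\tau}_r)(\boldsymbol{\tau}_r\boldsymbol{\tau}_{r-1})\cdots(\boldsymbol{\tau}_r\cdots\boldsymbol{\tau}_1)(\boldsymbol{\tau}_r\cdots\boldsymbol{\tau}_1\boldsymbol{\tau}_0)$. -}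

module Defs where

open import Data.Nat using (ℕ; zero; suc; _+_; _∸_; _≤_; _≡ᵇ_; _≤ᵇ_)
open import Data.Bool using (Bool; true; false; not; _∧_; _∨_; if_then_else_)
open import Data.List using (List; []; _∷_; map; filter; zip; upTo; concatMap; foldl)
open import Data.Bool.ListAction using (any; all)
open import Data.Product using (_×_; _,_; proj₁; proj₂)
open import Relation.Binary.PropositionalEquality using (_≡_)

Interval : Set
Interval = ℕ × ℕ

-- A subset of intervals, as a (decidable) characteristic function:
-- S i j ≡ true  means  [i,j] ∈ S.
IntSet : Set
IntSet = ℕ → ℕ → Bool

range1 : ℕ → List ℕ
range1 n = map suc (upTo n)

rankElems : ℕ → ℕ → List Interval
rankElems n k = map (λ i → (i , i + k)) (range1 (n ∸ k))

allElems : ℕ → List Interval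
allElems n = concatMap (rankElems n) (upTo n)

InPoset : ℕ → ℕ → ℕ → Set
InPoset n i j = (1 ≤ i) × (i ≤ j) × (j ≤ n)

IsAntichain : ℕ → IntSet → Set
IsAntichain n A =
  (∀ i j → A i j ≡ true → InPoset n i j) ×
  (∀ i j k l → A i j ≡ true → A k l ≡ true → k ≤ i → j ≤ l → (i ≡ k) × (j ≡ l))

eqI : Interval → Interval → Bool
eqI (i , j) (k , l) = (i ≡ᵇ k) ∧ (j ≡ᵇ l)

subI : Interval → Interval → Bool
subI (i , j) (k , l) = (k ≤ᵇ i) ∧ (j ≤ᵇ l)

comparable : Interval → Interval → Bool
comparable p q = subI p q ∨ subI q p

-- A ∪ {p} is an antichain (given that A is an antichain of A^n and p ∈ A^n, p ∉ A):
-- no element q of A (q ∈ A^n) is comparable with p.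
canAdd : ℕ → IntSet → Interval → Bool
canAdd n A p = all (λ q → not (A (proj₁ q) (proj₂ q) ∧ comparable p q)) (allElems n)

toggle : ℕ → Interval → IntSet → IntSet
toggle n p A with A (proj₁ p) (proj₂ p)
... | true  = λ i j → if eqI (i , j) p then false else A i j
... | false with canAdd n A p
...   | true  = λ i j → if eqI (i , j) p then true else A i j
...   | false = A

-- τ_k = product of τ_p over rank-k elements p.  Elements of equal rank are
-- pairwise incomparable, so these toggles commute; we apply them in order of
-- increasing left endpoint.
toggleRank : ℕ → ℕ → IntSet → IntSet
toggleRank n k A = foldl (λ B p → toggle n p B) A (rankElems n k)

rk : ℕ → ℕ
rk n = n ∸ 1

-- τ_r ⋯ τ_{s+1} τ_s  (τ_s applied first), for s ≤ r; m counts the remaining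
-- number of ranks to toggle.
upFrom : ℕ → ℕ → ℕ → IntSet → IntSet
upFrom n s zero    A = A
upFrom n s (suc m) A = upFrom n (suc s) m (toggleRank n s A)

-- (τ_r ⋯ τ_s)  for s = 0, then s = 1, ..., then s = r  (applied in this order,
-- i.e. rvac = (τ_r)(τ_r τ_{r-1}) ⋯ (τ_r ⋯ τ_0), rightmost first).
rvacAux : ℕ → ℕ → ℕ → IntSet → IntSet
rvacAux n s zero    A = A
rvacAux n s (suc m) A = rvacAux n (suc s) m (upFrom n s (suc (rk n) ∸ s) A)

rvac : ℕ → IntSet → IntSet
rvac n A = rvacAux n 0 (suc (rk n)) A

isRightEnd : ℕ → IntSet → ℕ → Bool
isRightEnd n A x = any (λ q → A (proj₁ q) (proj₂ q) ∧ (proj₂ q ≡ᵇ x)) (allElems n)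

isLeftEnd : ℕ → IntSet → ℕ → Bool
isLeftEnd n A x = any (λ q → A (proj₁ q) (proj₂ q) ∧ (proj₁ q ≡ᵇ x)) (allElems n)

LKList : ℕ → IntSet → List Interval
LKList n A = zip (filter (λ x → not (isRightEnd n A x) Data.Bool.≟ true) (range1 n))
                 (filter (λ x → not (isLeftEnd n A x) Data.Bool.≟ true) (range1 n))

LK : ℕ → IntSet → IntSet
LK n A i j = any (eqI (i , j)) (LKList n A)

module Submission where

-- The first pass τ_r ⋯ τ_0 of rvac sends A to its rowmotion, the minimal intervals not below any
-- element of A: toggling rank k adds exactly the minimal intervals of rank k once the lower ranks
-- are done.  A singleton [x , x] is such a minimal interval iff no element of A covers x, and
-- counting left and right ends of A shows these are also the singletons of LK(A); an interval
-- containing an uncovered point lies in neither set.  Every other interval lies in a maximal run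
-- o + 1 , ... , o + m + 1 of covered points.  Read inside that run, with ranks lowered by one, the
-- remaining passes of rvac are the passes of rvac on A^m, and the run has the left and right ends
-- of A shifted, so LK restricts in the same way; induction on n concludes.

open import Defs
open import Data.Bool using (Bool; true; false; not; _∧_; T; if_then_else_)
import Data.Bool as Bool
open import Data.Bool.Properties using (T-≡; ∧-zeroʳ)
open import Data.Bool.ListAction using (any; all)
open import Data.Empty using (⊥; ⊥-elim)
open import Data.List using (List; []; _∷_; map; filter; zip; upTo; applyUpTo; foldl)
open import Data.List.Properties using (map-applyUpTo)
open import Data.List.Membership.Propositional using (_∈_; find; lose)
open import Data.List.Membership.Propositional.Properties
  using (∈-map⁻; ∈-map⁺; ∈-upTo⁻; ∈-upTo⁺; ∈-concatMap⁻; ∈-concatMap⁺)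
open import Data.List.Relation.Unary.Any using (here; there)
import Data.List.Relation.Unary.Any as Any
import Data.List.Relation.Unary.All as All
open import Data.List.Relation.Unary.Any.Properties using (any⁺; any⁻)
open import Data.List.Relation.Unary.All.Properties using (all⁺; all⁻)
open import Data.Maybe using (Maybe; just; nothing)
open import Data.Nat using (ℕ; zero; suc; pred; _+_; _∸_; _≤_; _<_; _≤ᵇ_; _≡ᵇ_; z≤n; s≤s; z<s; _≤?_; _<?_; _≟_)
open import Data.Nat.Properties
open import Data.Nat.Induction using (<-rec)
open import Data.Nat.Tactic.RingSolver using (solve-∀)
open import Data.Product using (_×_; _,_; proj₁; proj₂; ∃-syntax)
open import Data.Sum using (_⊎_; inj₁; inj₂)
open import Function using (_∘_; case_of_)
open import Function.Bundles using (Equivalence)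
open import Relation.Binary.Definitions using (tri<; tri≈; tri>)
open import Relation.Binary.PropositionalEquality
open import Relation.Nullary using (¬_; Dec; yes; no; does; ¬?)
open import Relation.Nullary.Decidable using (dec-true; dec-false; decidable-stable)

true≢false : true ≢ false
true≢false ()

T⇒≡true : ∀ {b} → T b → b ≡ true
T⇒≡true = Equivalence.to T-≡

≡true⇒T : ∀ {b} → b ≡ true → T b
≡true⇒T = Equivalence.from T-≡

≢true⇒≡false : ∀ {b} → ¬ (b ≡ true) → b ≡ false
≢true⇒≡false {false} _ = refl
≢true⇒≡false {true}  h = ⊥-elim (h refl)

∧-true⁺ : ∀ {a b} → a ≡ true → b ≡ true → a ∧ b ≡ true
∧-true⁺ refl refl = refl

∧-true⁻ : ∀ {a b} → a ∧ b ≡ true → a ≡ true × b ≡ true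
∧-true⁻ {true} {true} _ = refl , refl

not-true⁻ : ∀ {b} → not b ≡ true → b ≡ false
not-true⁻ {false} _ = refl

bool-ext : ∀ {a b : Bool} → (a ≡ true → b ≡ true) → (b ≡ true → a ≡ true) → a ≡ b
bool-ext {true}  {true}  _ _ = refl
bool-ext {true}  {false} f _ = sym (f refl)
bool-ext {false} {true}  _ g = g refl
bool-ext {false} {false} _ _ = refl

≤⇒≤ᵇ≡true : ∀ {m n} → m ≤ n → (m ≤ᵇ n) ≡ true
≤⇒≤ᵇ≡true p = T⇒≡true (≤⇒≤ᵇ p)

≤ᵇ≡true⇒≤ : ∀ {m n} → (m ≤ᵇ n) ≡ true → m ≤ n
≤ᵇ≡true⇒≤ {m} {n} e = ≤ᵇ⇒≤ m n (≡true⇒T e)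

≡ᵇ≡true⇒≡ : ∀ {m n} → (m ≡ᵇ n) ≡ true → m ≡ n
≡ᵇ≡true⇒≡ {m} {n} e = ≡ᵇ⇒≡ m n (≡true⇒T e)

≡ᵇ-refl : ∀ m → (m ≡ᵇ m) ≡ true
≡ᵇ-refl m = T⇒≡true (≡⇒≡ᵇ m m refl)

module _ {A : Set} (f : A → Bool) where

  all-true⁻ : ∀ xs → all f xs ≡ true → ∀ {x} → x ∈ xs → f x ≡ true
  all-true⁻ xs e x∈xs = T⇒≡true (All.lookup (all⁺ f xs (≡true⇒T e)) x∈xs)

  all-true⁺ : ∀ xs → (∀ {x} → x ∈ xs → f x ≡ true) → all f xs ≡ true
  all-true⁺ xs h = T⇒≡true (all⁻ f (All.tabulate (λ x∈xs → ≡true⇒T (h x∈xs))))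

  any-true⁻ : ∀ xs → any f xs ≡ true → ∃[ x ] (x ∈ xs × f x ≡ true)
  any-true⁻ xs e with x , x∈xs , fx ← find (any⁻ f xs (≡true⇒T e)) = x , x∈xs , T⇒≡true fx

  any-true⁺ : ∀ xs {x} → x ∈ xs → f x ≡ true → any f xs ≡ true
  any-true⁺ xs x∈xs fx = T⇒≡true (any⁺ f (lose x∈xs (≡true⇒T fx)))

  any-false⁻ : ∀ xs → any f xs ≡ false → ∀ {x} → x ∈ xs → f x ≡ false
  any-false⁻ xs e x∈xs = ≢true⇒≡false λ fx → true≢false (trans (sym (any-true⁺ xs x∈xs fx)) e)

all-cong : ∀ {A : Set} {f g : A → Bool} xs → (∀ x → f x ≡ g x) → all f xs ≡ all g xs
all-cong []       h = refl
all-cong (y ∷ ys) h = cong₂ _∧_ (h y) (all-cong ys h)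

m<m+n⇒0<n : ∀ m {n} → m < m + n → 0 < n
m<m+n⇒0<n m {n} m<m+n = +-cancelˡ-< m 0 n (subst (_< m + n) (sym (+-identityʳ m)) m<m+n)

≤∸⇒+≤ : ∀ {i n k} → 1 ≤ i → i ≤ n ∸ k → i + k ≤ n
≤∸⇒+≤ {i} {n} {k} 1≤i i≤n∸k = m≤o∸n⇒m+n≤o i k≤n i≤n∸k
  where
  k≤n : k ≤ n
  k≤n = <⇒≤ (m∸n≢0⇒n<m λ e → <-irrefl refl (≤-trans 1≤i (subst (i ≤_) e i≤n∸k)))

∈-range1⁻ : ∀ {n x} → x ∈ range1 n → 1 ≤ x × x ≤ n
∈-range1⁻ x∈ with y , y∈ , refl ← ∈-map⁻ suc x∈ = s≤s z≤n , ∈-upTo⁻ y∈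

∈-range1⁺ : ∀ {n x} → 1 ≤ x → x ≤ n → x ∈ range1 n
∈-range1⁺ {x = suc y} _ x≤n = ∈-map⁺ suc (∈-upTo⁺ x≤n)

∈-allElems⁻ : ∀ {n i j} → (i , j) ∈ allElems n → InPoset n i j
∈-allElems⁻ {n} {i} {j} p
  with k , ij∈ ← Any.satisfied (∈-concatMap⁻ (rankElems n) {xs = upTo n} p)
  with y , y∈ , refl ← ∈-map⁻ (λ i → (i , i + k)) ij∈
  with 1≤i , i≤n∸k ← ∈-range1⁻ y∈
  = 1≤i , m≤m+n i k , ≤∸⇒+≤ 1≤i i≤n∸k

∈-allElems⁺ : ∀ {n i j} → InPoset n i j → (i , j) ∈ allElems n
∈-allElems⁺ {n} {i} (1≤i , i≤j , j≤n) with k , refl ← m≤n⇒∃[o]m+o≡n i≤j =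
  ∈-concatMap⁺ (rankElems n)
    (Any.map (λ { refl → ∈-map⁺ (λ i → (i , i + k)) (∈-range1⁺ 1≤i (m+n≤o⇒m≤o∸n i j≤n)) })
             (∈-upTo⁺ (<-≤-trans (m<n+m k 1≤i) j≤n)))

segment : ℕ → ℕ → List ℕ
segment c zero      = []
segment c (suc len) = c ∷ segment (suc c) len

range1≡segment : ∀ n → range1 n ≡ segment 1 n
range1≡segment n = trans (map-applyUpTo (λ z → z) suc n) (applyUpTo≡segment suc 1 n λ _ → refl)
  where
  applyUpTo≡segment : ∀ f c len → (∀ z → f z ≡ c + z) → applyUpTo f len ≡ segment c len
  applyUpTo≡segment f c zero      h = refl
  applyUpTo≡segment f c (suc len) h =
    cong₂ _∷_ (trans (h 0) (+-identityʳ c))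
              (applyUpTo≡segment (λ z → f (suc z)) (suc c) len λ z → trans (h (suc z)) (+-suc c z))

-- Toggles

infix 4 _≐_
_≐_ : IntSet → IntSet → Set
S ≐ S′ = ∀ i j → S i j ≡ S′ i j

≐-trans : ∀ {S₁ S₂ S₃} → S₁ ≐ S₂ → S₂ ≐ S₃ → S₁ ≐ S₃
≐-trans p q i j = trans (p i j) (q i j)

Comparable : Interval → Interval → Set
Comparable (i , j) (k , l) = (k ≤ i × j ≤ l) ⊎ (i ≤ k × l ≤ j)

comparable⁺ : ∀ p q → Comparable p q → comparable p q ≡ true
comparable⁺ (i , j) (k , l) (inj₁ (k≤i , j≤l)) rewrite ≤⇒≤ᵇ≡true k≤i | ≤⇒≤ᵇ≡true j≤l = refl
comparable⁺ (i , j) (k , l) (inj₂ (i≤k , l≤j)) rewrite ≤⇒≤ᵇ≡true i≤k | ≤⇒≤ᵇ≡true l≤j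
  with (k ≤ᵇ i) ∧ (j ≤ᵇ l)
... | true  = refl
... | false = refl

comparable⁻ : ∀ p q → comparable p q ≡ true → Comparable p q
comparable⁻ (i , j) (k , l) e with (k ≤ᵇ i) in e₁ | (j ≤ᵇ l) in e₂
... | true  | true  = inj₁ (≤ᵇ≡true⇒≤ e₁ , ≤ᵇ≡true⇒≤ e₂)
... | true  | false = let a , b = ∧-true⁻ {i ≤ᵇ k} e in inj₂ (≤ᵇ≡true⇒≤ a , ≤ᵇ≡true⇒≤ b)
... | false | _     = let a , b = ∧-true⁻ {i ≤ᵇ k} e in inj₂ (≤ᵇ≡true⇒≤ a , ≤ᵇ≡true⇒≤ b)

sameRank-comparable⇒≡ : ∀ {i c} k → Comparable (i , i + k) (c , c + k) → i ≡ c
sameRank-comparable⇒≡ {i} {c} k (inj₁ (c≤i , le)) = ≤-antisym (+-cancelʳ-≤ k i c le) c≤i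
sameRank-comparable⇒≡ {i} {c} k (inj₂ (i≤c , le)) = ≤-antisym i≤c (+-cancelʳ-≤ k c i le)

canAdd-true⁻ : ∀ n S p → canAdd n S p ≡ true →
               ∀ k l → InPoset n k l → S k l ≡ true → ¬ Comparable p (k , l)
canAdd-true⁻ n S p e k l kl∈ Skl c
  with all-true⁻ _ (allElems n) e (∈-allElems⁺ kl∈)
... | h rewrite Skl | comparable⁺ p (k , l) c with h
... | ()

canAdd-true⁺ : ∀ n S p → (∀ k l → InPoset n k l → S k l ≡ true → ¬ Comparable p (k , l)) →
               canAdd n S p ≡ true
canAdd-true⁺ n S p h = all-true⁺ _ (allElems n) λ { {k , l} kl∈ → free k l kl∈ }
  where
  free : ∀ k l → (k , l) ∈ allElems n → not (S k l ∧ comparable p (k , l)) ≡ true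
  free k l kl∈ with S k l in e₁ | comparable p (k , l) in e₂
  ... | false | _     = refl
  ... | true  | false = refl
  ... | true  | true  = ⊥-elim (h k l (∈-allElems⁻ kl∈) e₁ (comparable⁻ p (k , l) e₂))

canAdd-cong : ∀ n {S S′} p → (∀ k l → Comparable p (k , l) → S k l ≡ S′ k l) →
              canAdd n S p ≡ canAdd n S′ p
canAdd-cong n {S} {S′} p h = all-cong (allElems n) λ { (k , l) → agree k l }
  where
  agree : ∀ k l → not (S k l ∧ comparable p (k , l)) ≡ not (S′ k l ∧ comparable p (k , l))
  agree k l with comparable p (k , l) in e
  ... | false rewrite ∧-zeroʳ (S k l) | ∧-zeroʳ (S′ k l) = refl
  ... | true  rewrite h k l (comparable⁻ p (k , l) e) = refl

toggle-self : ∀ n a b S → toggle n (a , b) S a b ≡ not (S a b) ∧ canAdd n S (a , b)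
toggle-self n a b S with S a b in e
... | true  rewrite ≡ᵇ-refl a | ≡ᵇ-refl b = refl
... | false with canAdd n S (a , b)
...   | true  rewrite ≡ᵇ-refl a | ≡ᵇ-refl b = refl
...   | false = e

eqI-false : ∀ {i j a b} → (i , j) ≢ (a , b) → eqI (i , j) (a , b) ≡ false
eqI-false {i} {j} {a} {b} ij≢ab with eqI (i , j) (a , b) in e
... | false = refl
... | true with i≡a , j≡b ← ∧-true⁻ {i ≡ᵇ a} e = ⊥-elim (ij≢ab (cong₂ _,_ (≡ᵇ≡true⇒≡ i≡a) (≡ᵇ≡true⇒≡ j≡b)))

toggle-other : ∀ n p S i j → (i , j) ≢ p → toggle n p S i j ≡ S i j
toggle-other n (a , b) S i j ij≢ab with S a b
... | true rewrite eqI-false ij≢ab = refl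
... | false with canAdd n S (a , b)
...   | true rewrite eqI-false ij≢ab = refl
...   | false = refl

module _ (n k : ℕ) where
  private
    toggleEach : IntSet → List ℕ → IntSet
    toggleEach S cs = foldl (λ B p → toggle n p B) S (map (λ i → (i , i + k)) cs)

  toggleEach-off : ∀ len c S i j → ¬ (c ≤ i × i < c + len × j ≡ i + k) →
                   toggleEach S (segment c len) i j ≡ S i j
  toggleEach-off zero      c S i j h = refl
  toggleEach-off (suc len) c S i j h =
    trans (toggleEach-off len (suc c) (toggle n (c , c + k) S) i j
             λ (c<i , i<end , e) → h (<⇒≤ c<i , subst (i <_) (sym (+-suc c len)) i<end , e))
          (toggle-other n (c , c + k) S i j λ { refl → h (≤-refl , m<m+n c z<s , refl) })

  toggleEach-on : ∀ len c S i → c ≤ i → i < c + len →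
                  toggleEach S (segment c len) i (i + k) ≡ not (S i (i + k)) ∧ canAdd n S (i , i + k)
  toggleEach-on zero      c S i c≤i i<c = ⊥-elim (<⇒≱ (subst (i <_) (+-identityʳ c) i<c) c≤i)
  toggleEach-on (suc len) c S i c≤i i<end with i ≟ c
  ... | yes refl =
    trans (toggleEach-off len (suc i) (toggle n (i , i + k) S) i (i + k) λ (i<i , _) → <-irrefl refl i<i)
          (toggle-self n i (i + k) S)
  ... | no i≢c =
    trans (toggleEach-on len (suc c) S′ i (≤∧≢⇒< c≤i (i≢c ∘ sym)) (subst (i <_) (+-suc c len) i<end))
          (cong₂ _∧_ (cong not (toggle-other n (c , c + k) S i (i + k) (i≢c ∘ cong proj₁)))
                     (canAdd-cong n (i , i + k) λ k′ l cmp →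
                        toggle-other n (c , c + k) S k′ l λ { refl → i≢c (sameRank-comparable⇒≡ k cmp) }))
    where
    S′ = toggle n (c , c + k) S

InRank : ℕ → ℕ → ℕ → ℕ → Set
InRank n k i j = 1 ≤ i × i + k ≤ n × j ≡ i + k

inRank? : ∀ n k i j → Dec (InRank n k i j)
inRank? n k i j with 1 ≤? i | i + k ≤? n | j ≟ i + k
... | yes a | yes b | yes c = yes (a , b , c)
... | no ¬a | _     | _     = no (¬a ∘ proj₁)
... | _     | no ¬b | _     = no (¬b ∘ proj₁ ∘ proj₂)
... | _     | _     | no ¬c = no (¬c ∘ proj₂ ∘ proj₂)

InRank⇒InPoset : ∀ {n k i j} → InRank n k i j → InPoset n i j
InRank⇒InPoset {k = k} {i} (1≤i , i+k≤n , refl) = 1≤i , m≤m+n i k , i+k≤n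

diagonal∉InRank : ∀ {n k x} → 1 ≤ k → ¬ InRank n k x x
diagonal∉InRank {k = k} {x} 1≤k (_ , _ , x≡x+k) = <-irrefl x≡x+k (m<m+n x 1≤k)

toggleRank-on : ∀ n k S i j → InRank n k i j → toggleRank n k S i j ≡ not (S i j) ∧ canAdd n S (i , j)
toggleRank-on n k S i j (1≤i , i+k≤n , refl) rewrite range1≡segment (n ∸ k) =
  toggleEach-on n k (n ∸ k) 1 S i 1≤i (s≤s (m+n≤o⇒m≤o∸n i i+k≤n))

toggleRank-off : ∀ n k S i j → ¬ InRank n k i j → toggleRank n k S i j ≡ S i j
toggleRank-off n k S i j h rewrite range1≡segment (n ∸ k) =
  toggleEach-off n k (n ∸ k) 1 S i j λ (1≤i , i<1+n∸k , e) → h (1≤i , ≤∸⇒+≤ 1≤i (≤-pred i<1+n∸k) , e)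

toggleRank-cong : ∀ n k {S S′} → S ≐ S′ → toggleRank n k S ≐ toggleRank n k S′
toggleRank-cong n k {S} {S′} S≐S′ i j with inRank? n k i j
... | yes p rewrite toggleRank-on n k S i j p | toggleRank-on n k S′ i j p | S≐S′ i j
                  | canAdd-cong n {S} {S′} (i , j) (λ k l _ → S≐S′ k l) = refl
... | no ¬p rewrite toggleRank-off n k S i j ¬p | toggleRank-off n k S′ i j ¬p = S≐S′ i j

toggleRank-antichain : ∀ n k S → IsAntichain n S → IsAntichain n (toggleRank n k S)
toggleRank-antichain n k S (S⊆ , S-anti) = S⁺⊆ , S⁺-anti
  where
  S⁺ = toggleRank n k S
  added : ∀ i j → InRank n k i j → S⁺ i j ≡ true → canAdd n S (i , j) ≡ true
  added i j p e rewrite toggleRank-on n k S i j p = proj₂ (∧-true⁻ {not (S i j)} e)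
  S⁺⊆ : ∀ i j → S⁺ i j ≡ true → InPoset n i j
  S⁺⊆ i j e with inRank? n k i j
  ... | yes p = InRank⇒InPoset p
  ... | no ¬p rewrite toggleRank-off n k S i j ¬p = S⊆ i j e
  S⁺-anti : ∀ i j k′ l → S⁺ i j ≡ true → S⁺ k′ l ≡ true → k′ ≤ i → j ≤ l → (i ≡ k′) × (j ≡ l)
  S⁺-anti i j k′ l e₁ e₂ k′≤i j≤l with inRank? n k i j | inRank? n k k′ l
  ... | yes (_ , _ , refl) | yes (_ , _ , refl) =
        let i≡k′ = ≤-antisym (+-cancelʳ-≤ k i k′ j≤l) k′≤i in i≡k′ , cong (_+ k) i≡k′
  ... | yes p | no ¬q rewrite toggleRank-off n k S k′ l ¬q =
        ⊥-elim (canAdd-true⁻ n S (i , j) (added i j p e₁) k′ l (S⊆ k′ l e₂) e₂ (inj₁ (k′≤i , j≤l)))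
  ... | no ¬p | yes q rewrite toggleRank-off n k S i j ¬p =
        ⊥-elim (canAdd-true⁻ n S (k′ , l) (added k′ l q e₂) i j (S⊆ i j e₁) e₁ (inj₂ (k′≤i , j≤l)))
  ... | no ¬p | no ¬q rewrite toggleRank-off n k S i j ¬p | toggleRank-off n k S k′ l ¬q =
        S-anti i j k′ l e₁ e₂ k′≤i j≤l

upFrom-cong : ∀ n s c {S S′} → S ≐ S′ → upFrom n s c S ≐ upFrom n s c S′
upFrom-cong n s zero    S≐S′ = S≐S′
upFrom-cong n s (suc c) S≐S′ = upFrom-cong n (suc s) c (toggleRank-cong n s S≐S′)

rvacAux-cong : ∀ n s c {S S′} → S ≐ S′ → rvacAux n s c S ≐ rvacAux n s c S′
rvacAux-cong n s zero    S≐S′ = S≐S′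
rvacAux-cong n s (suc c) S≐S′ = rvacAux-cong n (suc s) c (upFrom-cong n s (suc (rk n) ∸ s) S≐S′)

upFrom-antichain : ∀ n s c S → IsAntichain n S → IsAntichain n (upFrom n s c S)
upFrom-antichain n s zero    S anti = anti
upFrom-antichain n s (suc c) S anti = upFrom-antichain n (suc s) c _ (toggleRank-antichain n s S anti)

rvacAux-antichain : ∀ n s c S → IsAntichain n S → IsAntichain n (rvacAux n s c S)
rvacAux-antichain n s zero    S anti = anti
rvacAux-antichain n s (suc c) S anti =
  rvacAux-antichain n (suc s) c _ (upFrom-antichain n s (suc (rk n) ∸ s) S anti)

upFrom-diagonal : ∀ n s c S x → 1 ≤ s → upFrom n s c S x x ≡ S x x
upFrom-diagonal n s zero    S x _   = refl
upFrom-diagonal n s (suc c) S x 1≤s =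
  trans (upFrom-diagonal n (suc s) c _ x (m≤n⇒m≤1+n 1≤s)) (toggleRank-off n s S x x (diagonal∉InRank 1≤s))

rvacAux-diagonal : ∀ n s c S x → 1 ≤ s → rvacAux n s c S x x ≡ S x x
rvacAux-diagonal n s zero    S x _   = refl
rvacAux-diagonal n s (suc c) S x 1≤s =
  trans (rvacAux-diagonal n (suc s) c _ x (m≤n⇒m≤1+n 1≤s)) (upFrom-diagonal n s (suc (rk n) ∸ s) S x 1≤s)

-- Rowmotion

Within : ℕ → IntSet → Set
Within n A = ∀ i j → A i j ≡ true → InPoset n i j

Below : IntSet → ℕ → ℕ → Set
Below A x y = ∃[ u ] ∃[ w ] (A u w ≡ true × u ≤ x × y ≤ w)

Below-mono : ∀ {A x y x′ y′} → Below A x y → x ≤ x′ → y′ ≤ y → Below A x′ y′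
Below-mono (u , w , Auw , u≤x , y≤w) x≤x′ y′≤y = u , w , Auw , ≤-trans u≤x x≤x′ , ≤-trans y′≤y y≤w

below? : ∀ {n A} → Within n A → ∀ x y → Dec (Below A x y)
below? {n} {A} A⊆ x y with any (λ q → A (proj₁ q) (proj₂ q) ∧ subI (x , y) q) (allElems n) in e
... | true with (u , w) , _ , found ← any-true⁻ _ (allElems n) e =
  let Auw , sub = ∧-true⁻ {A u w} found
      u≤x , y≤w = ∧-true⁻ {u ≤ᵇ x} sub
  in yes (u , w , Auw , ≤ᵇ≡true⇒≤ u≤x , ≤ᵇ≡true⇒≤ y≤w)
... | false = no λ (u , w , Auw , u≤x , y≤w) →
  true≢false (trans (sym (∧-true⁺ Auw (∧-true⁺ (≤⇒≤ᵇ≡true u≤x) (≤⇒≤ᵇ≡true y≤w))))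
                    (any-false⁻ _ (allElems n) e (∈-allElems⁺ (A⊆ u w Auw))))

-- The minimal elements of A^n outside the order ideal generated by A; they form the rowmotion of A.
MinNotBelow : ℕ → IntSet → ℕ → ℕ → Set
MinNotBelow n A x y = InPoset n x y × ¬ Below A x y × (x ≡ y ⊎ (Below A (suc x) y × Below A x (pred y)))

minNotBelow-proper : ∀ {n A x y k l} → MinNotBelow n A x y →
                     x ≤ k → k ≤ l → l ≤ y → x < k ⊎ l < y → Below A k l
minNotBelow-proper (_ , _ , inj₁ refl) x≤k k≤l l≤x (inj₁ x<k) = ⊥-elim (<⇒≱ x<k (≤-trans k≤l l≤x))
minNotBelow-proper (_ , _ , inj₁ refl) x≤k k≤l l≤x (inj₂ l<x) = ⊥-elim (<⇒≱ l<x (≤-trans x≤k k≤l))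
minNotBelow-proper (_ , _ , inj₂ (b₁ , _)) _ _ l≤y (inj₁ x<k) = Below-mono b₁ x<k l≤y
minNotBelow-proper (_ , _ , inj₂ (_ , b₂)) x≤k _ _ (inj₂ l<y) = Below-mono b₂ x≤k (<⇒≤pred l<y)

module _ {n A} (A⊆ : Within n A) where

  minNotBelow-inside′ : ∀ d x y → y ≡ x + d → InPoset n x y → ¬ Below A x y →
                        ∃[ x′ ] ∃[ y′ ] (x ≤ x′ × y′ ≤ y × MinNotBelow n A x′ y′)
  minNotBelow-inside′ zero x y y≡x xy∈ ¬b =
    x , y , ≤-refl , ≤-refl , xy∈ , ¬b , inj₁ (sym (trans y≡x (+-identityʳ x)))
  minNotBelow-inside′ (suc d) x y y≡x+1+d xy∈@(1≤x , _ , y≤n) ¬b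
    with below? A⊆ (suc x) y | below? A⊆ x (pred y)
  ... | yes b₁ | yes b₂ = x , y , ≤-refl , ≤-refl , xy∈ , ¬b , inj₂ (b₁ , b₂)
  ... | no ¬b₁ | _ =
    let y≡ = trans y≡x+1+d (+-suc x d)
        x′ , y′ , x<x′ , y′≤y , m = minNotBelow-inside′ d (suc x) y y≡
                                      (s≤s z≤n , subst (suc x ≤_) (sym y≡) (m≤m+n (suc x) d) , y≤n) ¬b₁
    in x′ , y′ , <⇒≤ x<x′ , y′≤y , m
  ... | yes _ | no ¬b₂ =
    let y-1≡ = cong pred (trans y≡x+1+d (+-suc x d))
        x′ , y′ , x≤x′ , y′≤y-1 , m = minNotBelow-inside′ d x (pred y) y-1≡
                                        (1≤x , subst (x ≤_) (sym y-1≡) (m≤m+n x d) , ≤-trans pred[n]≤n y≤n) ¬b₂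
    in x′ , y′ , x≤x′ , ≤-trans y′≤y-1 pred[n]≤n , m

  minNotBelow-inside : ∀ {x y} → InPoset n x y → ¬ Below A x y →
                       ∃[ x′ ] ∃[ y′ ] (x ≤ x′ × y′ ≤ y × MinNotBelow n A x′ y′)
  minNotBelow-inside {x} xy∈@(_ , x≤y , _) with d , refl ← m≤n⇒∃[o]m+o≡n x≤y =
    minNotBelow-inside′ d x _ refl xy∈

SweptElem : ℕ → IntSet → ℕ → ℕ → ℕ → Set
SweptElem n A k x y = (y < x + k × MinNotBelow n A x y) ⊎ (x + k ≤ y × A x y ≡ true)

-- S agrees with rowmotion of A in ranks below k and with A in ranks k and above.
Swept : ℕ → IntSet → ℕ → IntSet → Set
Swept n A k S = ∀ x y → (S x y ≡ true → SweptElem n A k x y) × (SweptElem n A k x y → S x y ≡ true)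

module SweepStep {n A} (A⊆ : Within n A) (k : ℕ) (S : IntSet) (swept : Swept n A k S) where

  sweptElem : ∀ {x y} → S x y ≡ true → SweptElem n A k x y
  sweptElem = proj₁ (swept _ _)

  inSwept : ∀ {x y} → SweptElem n A k x y → S x y ≡ true
  inSwept = proj₂ (swept _ _)

  S⊆ : Within n S
  S⊆ x y Sxy with sweptElem Sxy
  ... | inj₁ (_ , xy∈ , _) = xy∈
  ... | inj₂ (_ , Axy)     = A⊆ x y Axy

  S≡A-atRank : ∀ x → S x (x + k) ≡ A x (x + k)
  S≡A-atRank x = bool-ext (λ Sx → fromA (sweptElem Sx)) (λ Ax → inSwept (inj₂ (≤-refl , Ax)))
    where
    fromA : SweptElem n A k x (x + k) → A x (x + k) ≡ true
    fromA (inj₁ (lt , _)) = ⊥-elim (<-irrefl refl lt)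
    fromA (inj₂ (_ , Ax)) = Ax

  minNotBelow⇒canAdd : ∀ x → MinNotBelow n A x (x + k) → canAdd n S (x , x + k) ≡ true
  minNotBelow⇒canAdd x m@(_ , ¬b , _) = canAdd-true⁺ n S (x , x + k) λ k′ l _ Sk′l → free (sweptElem Sk′l)
    where
    free : ∀ {k′ l} → SweptElem n A k k′ l → ¬ Comparable (x , x + k) (k′ , l)
    free (inj₁ (l<k′+k , _)) (inj₁ (k′≤x , x+k≤l)) = <⇒≱ l<k′+k (≤-trans (+-monoˡ-≤ k k′≤x) x+k≤l)
    free {k′} {l} (inj₁ (l<k′+k , (_ , k′≤l , _) , ¬b′ , _)) (inj₂ (x≤k′ , l≤x+k)) with x ≟ k′
    ... | yes refl = ¬b′ (minNotBelow-proper m ≤-refl k′≤l l≤x+k (inj₂ l<k′+k))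
    ... | no x≢k′ = ¬b′ (minNotBelow-proper m x≤k′ k′≤l l≤x+k (inj₁ (≤∧≢⇒< x≤k′ x≢k′)))
    free (inj₂ (_ , Ak′l)) (inj₁ (k′≤x , x+k≤l)) = ¬b (_ , _ , Ak′l , k′≤x , x+k≤l)
    free (inj₂ (k′+k≤l , Ak′l)) (inj₂ (x≤k′ , l≤x+k)) =
      let k′≡x = ≤-antisym (+-cancelʳ-≤ k _ x (≤-trans k′+k≤l l≤x+k)) x≤k′
      in ¬b (_ , _ , Ak′l , ≤-reflexive k′≡x , ≤-trans (≤-reflexive (cong (_+ k) (sym k′≡x))) k′+k≤l)

  canAdd⇒minNotBelow : ∀ x → InRank n k x (x + k) → canAdd n S (x , x + k) ≡ true → MinNotBelow n A x (x + k)
  canAdd⇒minNotBelow x r@(1≤x , _ , _) free = xy∈ , ¬b , lowerCovers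
    where
    xy∈ = InRank⇒InPoset r
    y = x + k
    clash : ∀ {k′ l} → S k′ l ≡ true → ¬ Comparable (x , y) (k′ , l)
    clash Sk′l = canAdd-true⁻ n S (x , y) free _ _ (S⊆ _ _ Sk′l) Sk′l
    ¬b : ¬ Below A x y
    ¬b (u , w , Auw , u≤x , y≤w) =
      clash (inSwept (inj₂ (≤-trans (+-monoˡ-≤ k u≤x) y≤w , Auw))) (inj₁ (u≤x , y≤w))
    belowInside : ∀ x′ y′ → x ≤ x′ → y′ ≤ y → x < x′ ⊎ y′ < y → InPoset n x′ y′ → Below A x′ y′
    belowInside x′ y′ x≤x′ y′≤y proper xy′∈ with below? A⊆ x′ y′
    ... | yes b = b
    ... | no ¬b′ with a , b , x′≤a , b≤y′ , m ← minNotBelow-inside A⊆ xy′∈ ¬b′ =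
      ⊥-elim (clash (inSwept (inj₁ (smaller proper , m))) (inj₂ (≤-trans x≤x′ x′≤a , ≤-trans b≤y′ y′≤y)))
      where
      smaller : x < x′ ⊎ y′ < y → b < a + k
      smaller (inj₁ x<x′) = ≤-<-trans (≤-trans b≤y′ y′≤y) (+-monoˡ-< k (<-≤-trans x<x′ x′≤a))
      smaller (inj₂ y′<y) = <-≤-trans (≤-<-trans b≤y′ y′<y) (+-monoˡ-≤ k (≤-trans x≤x′ x′≤a))
    lowerCovers : x ≡ y ⊎ (Below A (suc x) y × Below A x (pred y))
    lowerCovers with x ≟ y
    ... | yes x≡y = inj₁ x≡y
    ... | no x≢y =
      inj₂ ( belowInside (suc x) y (n≤1+n x) ≤-refl (inj₁ ≤-refl) (s≤s z≤n , x<y , y≤n)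
           , belowInside x (pred y) ≤-refl pred[n]≤n (inj₂ (pred< x<y)) (1≤x , <⇒≤pred x<y , ≤-trans pred[n]≤n y≤n))
      where
      x<y = ≤∧≢⇒< (m≤m+n x k) x≢y
      y≤n = proj₂ (proj₂ xy∈)
      pred< : ∀ {a b} → a < b → pred b < b
      pred< (s≤s _) = ≤-refl

  toggleRank-swept : Swept n A (suc k) (toggleRank n k S)
  toggleRank-swept x y with inRank? n k x y
  ... | yes r@(_ , _ , refl) rewrite toggleRank-on n k S x y r | S≡A-atRank x = to , from
    where
    x+k<x+1+k : x + k < x + suc k
    x+k<x+1+k = +-monoʳ-< x ≤-refl
    to : not (A x (x + k)) ∧ canAdd n S (x , x + k) ≡ true → SweptElem n A (suc k) x (x + k)
    to e = inj₁ (x+k<x+1+k , canAdd⇒minNotBelow x r (proj₂ (∧-true⁻ {not (A x (x + k))} e)))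
    from : SweptElem n A (suc k) x (x + k) → not (A x (x + k)) ∧ canAdd n S (x , x + k) ≡ true
    from (inj₁ (_ , m@(_ , ¬b , _))) =
      ∧-true⁺ (cong not (≢true⇒≡false λ Ax → ¬b (x , x + k , Ax , ≤-refl , ≤-refl))) (minNotBelow⇒canAdd x m)
    from (inj₂ (x+1+k≤x+k , _)) = ⊥-elim (<⇒≱ x+k<x+1+k x+1+k≤x+k)
  ... | no ¬r rewrite toggleRank-off n k S x y ¬r = to , from
    where
    x+k≤x+1+k : x + k ≤ x + suc k
    x+k≤x+1+k = +-monoʳ-≤ x (n≤1+n k)
    inRank : InPoset n x y → x + k ≡ y → InRank n k x y
    inRank (1≤x , _ , y≤n) e = 1≤x , subst (_≤ n) (sym e) y≤n , sym e
    to : S x y ≡ true → SweptElem n A (suc k) x y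
    to Sxy with sweptElem Sxy
    ... | inj₁ (y<x+k , m) = inj₁ (<-≤-trans y<x+k x+k≤x+1+k , m)
    ... | inj₂ (x+k≤y , Axy) with x + k ≟ y
    ...   | yes e = ⊥-elim (¬r (inRank (A⊆ x y Axy) e))
    ...   | no x+k≢y = inj₂ (subst (_≤ y) (sym (+-suc x k)) (≤∧≢⇒< x+k≤y x+k≢y) , Axy)
    from : SweptElem n A (suc k) x y → S x y ≡ true
    from (inj₁ (y<x+1+k , m)) with x + k ≟ y
    ... | yes e = ⊥-elim (¬r (inRank (proj₁ m) e))
    ... | no x+k≢y = inSwept (inj₁ (≤∧≢⇒< (≤-pred (subst (y <_) (+-suc x k) y<x+1+k)) (x+k≢y ∘ sym) , m))
    from (inj₂ (x+1+k≤y , Axy)) = inSwept (inj₂ (≤-trans x+k≤x+1+k x+1+k≤y , Axy))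

upFrom-swept : ∀ {n A} → Within n A → ∀ c s S → Swept n A s S → Swept n A (s + c) (upFrom n s c S)
upFrom-swept A⊆ zero    s S swept rewrite +-identityʳ s = swept
upFrom-swept A⊆ (suc c) s S swept rewrite +-suc s c =
  upFrom-swept A⊆ c (suc s) _ (SweepStep.toggleRank-swept A⊆ s S swept)

rowmotion : ℕ → IntSet → IntSet
rowmotion n A = upFrom n 0 n A

module _ {n A} (A⊆ : Within n A) where

  private
    rowmotion-swept : Swept n A n (rowmotion n A)
    rowmotion-swept = upFrom-swept A⊆ n 0 A λ x y → to x y , from x y
      where
      to : ∀ x y → A x y ≡ true → SweptElem n A 0 x y
      to x y Axy = inj₂ (subst (_≤ y) (sym (+-identityʳ x)) (proj₁ (proj₂ (A⊆ x y Axy))) , Axy)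
      from : ∀ x y → SweptElem n A 0 x y → A x y ≡ true
      from x y (inj₁ (y<x+0 , (_ , x≤y , _) , _)) = ⊥-elim (<⇒≱ y<x+0 (subst (_≤ y) (sym (+-identityʳ x)) x≤y))
      from x y (inj₂ (_ , Axy)) = Axy

  rowmotion⁻ : ∀ {x y} → rowmotion n A x y ≡ true → MinNotBelow n A x y
  rowmotion⁻ {x} {y} e with proj₁ (rowmotion-swept x y) e
  ... | inj₁ (_ , m) = m
  ... | inj₂ (x+n≤y , Axy) with 1≤x , _ , y≤n ← A⊆ x y Axy =
    ⊥-elim (<⇒≱ (<-≤-trans (s≤s y≤n) (+-monoˡ-≤ n 1≤x)) x+n≤y)

  rowmotion⁺ : ∀ {x y} → MinNotBelow n A x y → rowmotion n A x y ≡ true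
  rowmotion⁺ {x} {y} m@((1≤x , _ , y≤n) , _) =
    proj₂ (rowmotion-swept x y) (inj₁ (<-≤-trans (s≤s y≤n) (+-monoˡ-≤ n 1≤x) , m))

-- Counting, and the list description of LK

ind : Bool → ℕ
ind b = if b then 1 else 0

count : (ℕ → Bool) → ℕ → ℕ → ℕ
count p c zero      = 0
count p c (suc len) = ind (p c) + count p (suc c) len

count-snoc : ∀ p c len → count p c (suc len) ≡ count p c len + ind (p (c + len))
count-snoc p c zero rewrite +-identityʳ c = +-comm (ind (p c)) 0
count-snoc p c (suc len) rewrite count-snoc p (suc c) len | +-suc c len =
  sym (+-assoc (ind (p c)) (count p (suc c) len) _)

count-++ : ∀ p c a b → count p c (a + b) ≡ count p c a + count p (c + a) b
count-++ p c zero b rewrite +-identityʳ c = refl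
count-++ p c (suc a) b rewrite count-++ p (suc c) a b | +-suc c a =
  sym (+-assoc (ind (p c)) (count p (suc c) a) _)

count-complement : ∀ p c len → count p c len + count (not ∘ p) c len ≡ len
count-complement p c zero = refl
count-complement p c (suc len) with p c
... | true  = cong suc (count-complement p (suc c) len)
... | false = trans (+-suc (count p (suc c) len) _) (cong suc (count-complement p (suc c) len))

count-cong : ∀ {p q} c len → (∀ z → c ≤ z → z < c + len → p z ≡ q z) → count p c len ≡ count q c len
count-cong c zero h = refl
count-cong c (suc len) h =
  cong₂ _+_ (cong ind (h c ≤-refl (m<m+n c z<s)))
            (count-cong (suc c) len λ z c<z z<end → h z (<⇒≤ c<z) (subst (z <_) (sym (+-suc c len)) z<end))

count-shift : ∀ p s c len → count (λ z → p (z + s)) c len ≡ count p (c + s) len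
count-shift p s c zero      = refl
count-shift p s c (suc len) = cong (ind (p (c + s)) +_) (count-shift p s (suc c) len)

count-monoʳ : ∀ p c {a b} → a ≤ b → count p c a ≤ count p c b
count-monoʳ p c {a} a≤b with e , refl ← m≤n⇒∃[o]m+o≡n a≤b =
  subst (count p c a ≤_) (sym (count-++ p c a e)) (m≤m+n _ _)

count-none : ∀ p c len → (∀ z → c ≤ z → z < c + len → p z ≡ false) → count p c len ≡ 0
count-none p c zero      h = refl
count-none p c (suc len) h rewrite h c ≤-refl (m<m+n c z<s) =
  count-none p (suc c) len λ z c<z z<end → h z (<⇒≤ c<z) (subst (z <_) (sym (+-suc c len)) z<end)

count-none⁻ : ∀ p c len → count p c len ≡ 0 → ∀ z → c ≤ z → z < c + len → p z ≡ false
count-none⁻ p c zero      _ z c≤z z<c = ⊥-elim (<⇒≱ (subst (z <_) (+-identityʳ c) z<c) c≤z)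
count-none⁻ p c (suc len) e z c≤z z<end with p c in pc
... | false with c ≟ z
...   | yes refl = pc
...   | no c≢z = count-none⁻ p (suc c) len e z (≤∧≢⇒< c≤z c≢z) (subst (z <_) (+-suc c len) z<end)

count-unique : ∀ p c len z₀ → c ≤ z₀ → z₀ < c + len → p z₀ ≡ true →
               (∀ z → p z ≡ true → z ≡ z₀) → count p c len ≡ 1
count-unique p c zero z₀ c≤z₀ z₀<c _ _ = ⊥-elim (<⇒≱ (subst (z₀ <_) (+-identityʳ c) z₀<c) c≤z₀)
count-unique p c (suc len) z₀ c≤z₀ z₀<end pz₀ unique with c ≟ z₀
... | yes refl rewrite pz₀ = cong suc (count-none p (suc c) len λ z c<z _ → ≢true⇒≡false λ pz →
                               <-irrefl (sym (unique z pz)) c<z)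
... | no c≢z₀ rewrite ≢true⇒≡false {p c} (c≢z₀ ∘ unique c) =
  count-unique p (suc c) len z₀ (≤∧≢⇒< c≤z₀ c≢z₀) (subst (z₀ <_) (+-suc c len) z₀<end) pz₀ unique

count-+ : ∀ p q r c len → (∀ z → ind (p z) + ind (q z) ≡ ind (r z)) →
          count p c len + count q c len ≡ count r c len
count-+ p q r c zero      h = refl
count-+ p q r c (suc len) h =
  trans (interchange (ind (p c)) (count p (suc c) len) (ind (q c)) (count q (suc c) len))
        (cong₂ _+_ (h c) (count-+ p q r (suc c) len h))
  where
  interchange : ∀ a b c d → (a + b) + (c + d) ≡ (a + c) + (b + d)
  interchange = solve-∀

nth : {X : Set} → List X → ℕ → Maybe X
nth []       t       = nothing
nth (x ∷ xs) zero    = just x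
nth (x ∷ xs) (suc t) = nth xs t

∈-zip⁻ : ∀ {X Y : Set} (xs : List X) (ys : List Y) {x y} → (x , y) ∈ zip xs ys →
         ∃[ t ] (nth xs t ≡ just x × nth ys t ≡ just y)
∈-zip⁻ (_ ∷ _)  (_ ∷ _)  (here refl) = 0 , refl , refl
∈-zip⁻ (_ ∷ xs) (_ ∷ ys) (there p) with t , e₁ , e₂ ← ∈-zip⁻ xs ys p = suc t , e₁ , e₂

∈-zip⁺ : ∀ {X Y : Set} (xs : List X) (ys : List Y) {x y} t → nth xs t ≡ just x → nth ys t ≡ just y →
         (x , y) ∈ zip xs ys
∈-zip⁺ (_ ∷ _)  (_ ∷ _)  zero    refl refl = here refl
∈-zip⁺ (_ ∷ xs) (_ ∷ ys) (suc t) e₁   e₂   = there (∈-zip⁺ xs ys t e₁ e₂)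

filterᵗ : (ℕ → Bool) → List ℕ → List ℕ
filterᵗ p = filter (λ z → p z Bool.≟ true)

nth-filter⁻ : ∀ p len c t {x} → nth (filterᵗ p (segment c len)) t ≡ just x →
              ∃[ d ] (x ≡ c + d × d < len × p x ≡ true × count p c d ≡ t)
nth-filter⁻ p (suc len) c t e with p c in pc
nth-filter⁻ p (suc len) c zero refl | true = 0 , sym (+-identityʳ c) , z<s , pc , refl
nth-filter⁻ p (suc len) c (suc t) e | true with d , x≡ , d<len , px , counted ← nth-filter⁻ p len (suc c) t e =
  suc d , trans x≡ (sym (+-suc c d)) , s≤s d<len , px ,
  trans (cong (λ b → ind b + count p (suc c) d) pc) (cong suc counted)
nth-filter⁻ p (suc len) c t e | false with d , x≡ , d<len , px , counted ← nth-filter⁻ p len (suc c) t e =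
  suc d , trans x≡ (sym (+-suc c d)) , s≤s d<len , px , trans (cong (λ b → ind b + count p (suc c) d) pc) counted

nth-filter⁺ : ∀ p len c d → d < len → p (c + d) ≡ true →
              nth (filterᵗ p (segment c len)) (count p c d) ≡ just (c + d)
nth-filter⁺ p (suc len) c zero    _          pc rewrite +-identityʳ c | pc = refl
nth-filter⁺ p (suc len) c (suc d) (s≤s d<len) pc+d rewrite +-suc c d with p c
... | true  = nth-filter⁺ p len (suc c) d d<len pc+d
... | false = nth-filter⁺ p len (suc c) d d<len pc+d

nonRight nonLeft : ℕ → IntSet → ℕ → Bool
nonRight n A x = not (isRightEnd n A x)
nonLeft  n A x = not (isLeftEnd n A x)

-- [suc di , suc dj] ∈ LK(A): for some t, suc di is the t-th non-right end and suc dj the t-th non-left end.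
record LKPair (n : ℕ) (A : IntSet) (di dj : ℕ) : Set where
  constructor lkPair
  field
    di<n       : di < n
    dj<n       : dj < n
    nonRight-i : nonRight n A (suc di) ≡ true
    nonLeft-j  : nonLeft n A (suc dj) ≡ true
    balanced   : count (nonRight n A) 1 di ≡ count (nonLeft n A) 1 dj

LK-true⁻ : ∀ n A i j → LK n A i j ≡ true → ∃[ di ] ∃[ dj ] (i ≡ suc di × j ≡ suc dj × LKPair n A di dj)
LK-true⁻ n A i j e
  with (a , b) , ab∈ , ij≡ab ← any-true⁻ (eqI (i , j)) (LKList n A) e
  with refl ← ≡ᵇ≡true⇒≡ {i} {a} (proj₁ (∧-true⁻ {i ≡ᵇ a} ij≡ab))
  with refl ← ≡ᵇ≡true⇒≡ {j} {b} (proj₂ (∧-true⁻ {i ≡ᵇ a} ij≡ab))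
  with t , e₁ , e₂ ← ∈-zip⁻ (filterᵗ (nonRight n A) (range1 n)) (filterᵗ (nonLeft n A) (range1 n)) ab∈
  rewrite range1≡segment n
  with di , refl , di<n , nri , ci ← nth-filter⁻ (nonRight n A) n 1 t e₁
  with dj , refl , dj<n , nlj , cj ← nth-filter⁻ (nonLeft n A) n 1 t e₂
  = di , dj , refl , refl , lkPair di<n dj<n nri nlj (trans ci (sym cj))

LK-true⁺ : ∀ {n A di dj} → LKPair n A di dj → LK n A (suc di) (suc dj) ≡ true
LK-true⁺ {n} {A} {di} {dj} (lkPair di<n dj<n nri nlj bal) =
  any-true⁺ (eqI (suc di , suc dj)) (LKList n A) member
            (∧-true⁺ (≡ᵇ-refl (suc di)) (≡ᵇ-refl (suc dj)))
  where
  member : (suc di , suc dj) ∈ LKList n A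
  member rewrite range1≡segment n =
    ∈-zip⁺ (filterᵗ (nonRight n A) (segment 1 n)) (filterᵗ (nonLeft n A) (segment 1 n)) _
           (nth-filter⁺ (nonRight n A) n 1 di di<n nri)
           (subst (λ t → nth (filterᵗ (nonLeft n A) (segment 1 n)) t ≡ just (suc dj)) (sym bal)
                  (nth-filter⁺ (nonLeft n A) n 1 dj dj<n nlj))

isRightEnd⁻ : ∀ n A x → isRightEnd n A x ≡ true → ∃[ u ] (A u x ≡ true)
isRightEnd⁻ n A x e with (u , w) , _ , found ← any-true⁻ _ (allElems n) e
  with Auw , w≡x ← ∧-true⁻ {A u w} found
  with refl ← ≡ᵇ≡true⇒≡ {w} w≡x = u , Auw

isRightEnd⁺ : ∀ {n A} → Within n A → ∀ {u x} → A u x ≡ true → isRightEnd n A x ≡ true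
isRightEnd⁺ {n} A⊆ {u} {x} Aux = any-true⁺ _ (allElems n) (∈-allElems⁺ (A⊆ u x Aux)) (∧-true⁺ Aux (≡ᵇ-refl x))

isLeftEnd⁻ : ∀ n A x → isLeftEnd n A x ≡ true → ∃[ w ] (A x w ≡ true)
isLeftEnd⁻ n A x e with (u , w) , _ , found ← any-true⁻ _ (allElems n) e
  with Auw , u≡x ← ∧-true⁻ {A u w} found
  with refl ← ≡ᵇ≡true⇒≡ {u} u≡x = w , Auw

isLeftEnd⁺ : ∀ {n A} → Within n A → ∀ {x w} → A x w ≡ true → isLeftEnd n A x ≡ true
isLeftEnd⁺ {n} A⊆ {x} {w} Axw = any-true⁺ _ (allElems n) (∈-allElems⁺ (A⊆ x w Axw)) (∧-true⁺ Axw (≡ᵇ-refl x))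

-- Ends of an antichain

module AntichainCounting {n A} (anti : IsAntichain n A) where

  A⊆ : Within n A
  A⊆ = proj₁ anti

  leftEnd-unique : ∀ {x w w′} → A x w ≡ true → A x w′ ≡ true → w ≡ w′
  leftEnd-unique {x} {w} {w′} Axw Axw′ with ≤-total w w′
  ... | inj₁ w≤w′ = proj₂ (proj₂ anti x w x w′ Axw Axw′ ≤-refl w≤w′)
  ... | inj₂ w′≤w = sym (proj₂ (proj₂ anti x w′ x w Axw′ Axw ≤-refl w′≤w))

  rightEnd-unique : ∀ {u u′ x} → A u x ≡ true → A u′ x ≡ true → u ≡ u′
  rightEnd-unique {u} {u′} {x} Aux Au′x with ≤-total u u′
  ... | inj₁ u≤u′ = sym (proj₁ (proj₂ anti u′ x u x Au′x Aux u≤u′ ≤-refl))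
  ... | inj₂ u′≤u = proj₁ (proj₂ anti u x u′ x Aux Au′x u′≤u ≤-refl)

  ends-ordered : ∀ {u w u′ w′} → A u w ≡ true → A u′ w′ ≡ true → u < u′ → w < w′
  ends-ordered {u} {w} {u′} {w′} Auw Au′w′ u<u′ with w <? w′
  ... | yes w<w′ = w<w′
  ... | no w≮w′ = ⊥-elim (<-irrefl (sym (proj₁ (proj₂ anti u′ w′ u w Au′w′ Auw (<⇒≤ u<u′) (≮⇒≥ w≮w′)))) u<u′)

  reaches : ℕ → ℕ → Bool
  reaches x z = any (λ q → A (proj₁ q) (proj₂ q) ∧ ((proj₁ q ≡ᵇ z) ∧ (x ≤ᵇ proj₂ q))) (allElems n)

  reaches⁻ : ∀ x z → reaches x z ≡ true → ∃[ w ] (A z w ≡ true × x ≤ w)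
  reaches⁻ x z e with (u , w) , _ , found ← any-true⁻ _ (allElems n) e
    with Auw , rest ← ∧-true⁻ {A u w} found
    with u≡z , x≤w ← ∧-true⁻ {u ≡ᵇ z} rest
    with refl ← ≡ᵇ≡true⇒≡ {u} u≡z = w , Auw , ≤ᵇ≡true⇒≤ x≤w

  reaches⁺ : ∀ {x z w} → A z w ≡ true → x ≤ w → reaches x z ≡ true
  reaches⁺ {x} {z} {w} Azw x≤w =
    any-true⁺ _ (allElems n) (∈-allElems⁺ (A⊆ z w Azw)) (∧-true⁺ Azw (∧-true⁺ (≡ᵇ-refl z) (≤⇒≤ᵇ≡true x≤w)))

  reaches-self : ∀ x → reaches x x ≡ isLeftEnd n A x
  reaches-self x = bool-ext (λ e → let w , Axw , _ = reaches⁻ x x e in isLeftEnd⁺ A⊆ Axw)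
                            (λ e → let w , Axw = isLeftEnd⁻ n A x e in reaches⁺ Axw (proj₁ (proj₂ (A⊆ x w Axw))))

  reaches-suc : ∀ x z → ind (reaches (suc x) z) + ind (A z x) ≡ ind (reaches x z)
  reaches-suc x z with A z x in Azx | reaches (suc x) z in r₁ | reaches x z in r₀
  ... | true  | false | true  = refl
  ... | false | true  | true  = refl
  ... | false | false | false = refl
  ... | true  | _     | false = ⊥-elim (true≢false (trans (sym (reaches⁺ Azx ≤-refl)) r₀))
  ... | true  | true  | _ with w , Azw , x<w ← reaches⁻ (suc x) z r₁ = ⊥-elim (<-irrefl (leftEnd-unique Azx Azw) x<w)
  ... | false | true  | false with w , Azw , x<w ← reaches⁻ (suc x) z r₁ =
    ⊥-elim (true≢false (trans (sym (reaches⁺ Azw (<⇒≤ x<w))) r₀))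
  ... | false | false | true with w , Azw , x≤w ← reaches⁻ x z r₀ with x ≟ w
  ...   | yes refl = ⊥-elim (true≢false (trans (sym Azw) Azx))
  ...   | no x≢w = ⊥-elim (true≢false (trans (sym (reaches⁺ Azw (≤∧≢⇒< x≤w x≢w))) r₁))

  count-rightEndAt : ∀ x → count (λ z → A z x) 1 x ≡ ind (isRightEnd n A x)
  count-rightEndAt x with isRightEnd n A x in r
  ... | true with u , Aux ← isRightEnd⁻ n A x r with 1≤u , u≤x , _ ← A⊆ u x Aux =
    count-unique _ 1 x u 1≤u (s≤s u≤x) Aux λ _ Azx → rightEnd-unique Azx Aux
  ... | false = count-none _ 1 x λ z _ _ → ≢true⇒≡false λ Azx → true≢false (trans (sym (isRightEnd⁺ A⊆ Azx)) r)

  -- Every element with left end in [1 , d] has its right end in [1 , d] or reaches d + 1.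
  leftEnds-balance : ∀ d → count (isLeftEnd n A) 1 d ≡ count (isRightEnd n A) 1 d + count (reaches (suc d)) 1 d
  leftEnds-balance zero    = refl
  leftEnds-balance (suc d) =
    begin
      count L 1 (suc d)
    ≡⟨ count-snoc L 1 d ⟩
      count L 1 d + ind (L (suc d))
    ≡⟨ cong₂ _+_ (leftEnds-balance d) (cong ind (sym (reaches-self (suc d)))) ⟩
      (cR + count (reaches (suc d)) 1 d) + ind (reaches (suc d) (suc d))
    ≡⟨ cong₂ (λ a b → (cR + a) + b) (sym (count-+ _ _ _ 1 d (reaches-suc (suc d))))
                                     (sym (reaches-suc (suc d) (suc d))) ⟩
      (cR + (cP + cA)) + (iP + iA)
    ≡⟨ rearrange cR cP cA iP iA ⟩
      (cR + (cA + iA)) + (cP + iP)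
    ≡⟨ cong₂ (λ a b → (cR + a) + b) (trans (sym (count-snoc (λ z → A z (suc d)) 1 d)) (count-rightEndAt (suc d)))
                                     (sym (count-snoc (reaches (suc (suc d))) 1 d)) ⟩
      (cR + ind (R (suc d))) + count (reaches (suc (suc d))) 1 (suc d)
    ≡⟨ cong (_+ count (reaches (suc (suc d))) 1 (suc d)) (sym (count-snoc R 1 d)) ⟩
      count R 1 (suc d) + count (reaches (suc (suc d))) 1 (suc d)
    ∎
    where
    open ≡-Reasoning
    L = isLeftEnd n A
    R = isRightEnd n A
    cR = count R 1 d
    cP = count (reaches (suc (suc d))) 1 d
    cA = count (λ z → A z (suc d)) 1 d
    iP = ind (reaches (suc (suc d)) (suc d))
    iA = ind (A (suc d) (suc d))
    rearrange : ∀ a b c d e → (a + (b + c)) + (d + e) ≡ (a + (c + e)) + (b + d)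
    rearrange = solve-∀

  Straddles : ℕ → Set
  Straddles x = ∃[ u ] ∃[ w ] (A u w ≡ true × u < x × x ≤ w)

  #nonRight #nonLeft : ℕ → ℕ
  #nonRight d = count (nonRight n A) 1 d
  #nonLeft  d = count (nonLeft n A) 1 d

  nonRight-balance : ∀ d → #nonRight d ≡ count (reaches (suc d)) 1 d + #nonLeft d
  nonRight-balance d = +-cancelˡ-≡ cR _ _ (begin
      cR + #nonRight d              ≡⟨ count-complement (isRightEnd n A) 1 d ⟩
      d                             ≡⟨ sym (count-complement (isLeftEnd n A) 1 d) ⟩
      count (isLeftEnd n A) 1 d + #nonLeft d ≡⟨ cong (_+ #nonLeft d) (leftEnds-balance d) ⟩
      (cR + cP) + #nonLeft d        ≡⟨ +-assoc cR cP _ ⟩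
      cR + (cP + #nonLeft d)        ∎)
    where
    open ≡-Reasoning
    cR = count (isRightEnd n A) 1 d
    cP = count (reaches (suc d)) 1 d

  #nonLeft≤#nonRight : ∀ d → #nonLeft d ≤ #nonRight d
  #nonLeft≤#nonRight d = subst (#nonLeft d ≤_) (sym (nonRight-balance d)) (m≤n+m _ _)

  balanced⇒¬straddles : ∀ d → #nonRight d ≡ #nonLeft d → ¬ Straddles (suc d)
  balanced⇒¬straddles d balanced (u , w , Auw , u<1+d , 1+d≤w) =
    true≢false (trans (sym (reaches⁺ Auw 1+d≤w))
                      (count-none⁻ (reaches (suc d)) 1 d noneReach u (proj₁ (A⊆ u w Auw)) u<1+d))
    where
    noneReach : count (reaches (suc d)) 1 d ≡ 0
    noneReach = +-cancelʳ-≡ (#nonLeft d) _ 0 (trans (sym (nonRight-balance d)) balanced)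

  ¬straddles⇒balanced : ∀ d → ¬ Straddles (suc d) → #nonRight d ≡ #nonLeft d
  ¬straddles⇒balanced d ¬s = trans (nonRight-balance d) (cong (_+ #nonLeft d) noneReach)
    where
    noneReach : count (reaches (suc d)) 1 d ≡ 0
    noneReach = count-none _ 1 d λ z _ z<1+d → ≢true⇒≡false λ r →
      let w , Azw , 1+d≤w = reaches⁻ (suc d) z r in ¬s (z , w , Azw , z<1+d , 1+d≤w)

  ¬Below⇒nonRight : ∀ {x} → ¬ Below A x x → nonRight n A x ≡ true
  ¬Below⇒nonRight {x} ¬b with isRightEnd n A x in e
  ... | false = refl
  ... | true with u , Aux ← isRightEnd⁻ n A x e = ⊥-elim (¬b (u , x , Aux , proj₁ (proj₂ (A⊆ u x Aux)) , ≤-refl))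

  ¬Below⇒nonLeft : ∀ {x} → ¬ Below A x x → nonLeft n A x ≡ true
  ¬Below⇒nonLeft {x} ¬b with isLeftEnd n A x in e
  ... | false = refl
  ... | true with w , Axw ← isLeftEnd⁻ n A x e = ⊥-elim (¬b (x , w , Axw , ≤-refl , proj₁ (proj₂ (A⊆ x w Axw))))

  ¬Below⇒balanced : ∀ d → ¬ Below A (suc d) (suc d) → #nonRight d ≡ #nonLeft d
  ¬Below⇒balanced d ¬b = ¬straddles⇒balanced d λ (u , w , Auw , u<x , x≤w) → ¬b (u , w , Auw , <⇒≤ u<x , x≤w)

count-step : ∀ p c len → p (c + len) ≡ true → count p c len < count p c (suc len)
count-step p c len pz rewrite count-snoc p c len | pz = m<m+n _ z<s

module LKFacts {n A} (anti : IsAntichain n A) where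
  open AntichainCounting anti

  LK-ordered : ∀ {i j} → LK n A i j ≡ true → i ≤ j
  LK-ordered {i} {j} e with di , dj , refl , refl , lkPair _ _ nri nlj balanced ← LK-true⁻ n A i j e
    with di ≤? dj
  ... | yes di≤dj = s≤s di≤dj
  ... | no di≰dj = ⊥-elim (balanced⇒¬straddles dj dj-balanced straddle)
    where
    bound : #nonRight dj + ind (nonRight n A (suc dj)) ≤ #nonLeft dj
    bound = ≤-trans (subst (_≤ #nonRight di) (count-snoc (nonRight n A) 1 dj) (count-monoʳ _ 1 (≰⇒> di≰dj)))
                    (≤-reflexive balanced)
    dj-balanced : #nonRight dj ≡ #nonLeft dj
    dj-balanced = ≤-antisym (≤-trans (m≤m+n _ _) bound) (#nonLeft≤#nonRight dj)
    rightEnd : isRightEnd n A (suc dj) ≡ true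
    rightEnd with isRightEnd n A (suc dj) in r
    ... | true = refl
    ... | false = ⊥-elim (<-irrefl refl (begin-strict
      #nonRight dj                                   <⟨ m<m+n _ z<s ⟩
      #nonRight dj + 1                               ≡⟨ cong (λ b → #nonRight dj + ind (not b)) r ⟨
      #nonRight dj + ind (nonRight n A (suc dj))     ≤⟨ bound ⟩
      #nonLeft dj                                    ≤⟨ #nonLeft≤#nonRight dj ⟩
      #nonRight dj                                   ∎))
      where open ≤-Reasoning
    straddle : Straddles (suc dj)
    straddle with u , Au ← isRightEnd⁻ n A (suc dj) rightEnd with u ≟ suc dj
    ... | yes refl = ⊥-elim (true≢false (trans (sym (isLeftEnd⁺ A⊆ Au)) (not-true⁻ nlj)))
    ... | no u≢ = u , suc dj , Au , ≤∧≢⇒< (proj₁ (proj₂ (A⊆ u _ Au))) u≢ , ≤-refl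

  LK-diagonal⁺ : ∀ {x} → 1 ≤ x → x ≤ n → ¬ Below A x x → LK n A x x ≡ true
  LK-diagonal⁺ {suc d} _ x≤n ¬b =
    LK-true⁺ (lkPair x≤n x≤n (¬Below⇒nonRight ¬b) (¬Below⇒nonLeft ¬b) (¬Below⇒balanced d ¬b))

  LK-diagonal⁻ : ∀ {x} → LK n A x x ≡ true → ¬ Below A x x
  LK-diagonal⁻ {x} e (u , w , Auw , u≤x , x≤w)
    with di , dj , refl , x≡ , lkPair _ _ _ nlx balanced ← LK-true⁻ n A x x e
    with refl ← suc-injective x≡ with u ≟ suc di
  ... | yes refl = true≢false (trans (sym (isLeftEnd⁺ A⊆ Auw)) (not-true⁻ nlx))
  ... | no u≢ = balanced⇒¬straddles di balanced (u , w , Auw , ≤∧≢⇒< u≤x u≢ , x≤w)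

  LK-covers : ∀ {i j z} → LK n A i j ≡ true → i < j → i ≤ z → z ≤ j → Below A z z
  LK-covers {i} {j} {zero} e _ i≤z _ with _ , _ , refl , _ ← LK-true⁻ n A i j e with i≤z
  ... | ()
  LK-covers {i} {j} {suc dz} e i<j i≤z z≤j with below? A⊆ (suc dz) (suc dz)
  ... | yes b = b
  ... | no ¬b with di , dj , refl , refl , lkPair _ _ nri nlj balanced ← LK-true⁻ n A i j e
    = ⊥-elim (contradiction (dz <? dj))
    where
    z-balanced : #nonRight dz ≡ #nonLeft dz
    z-balanced = ¬Below⇒balanced dz ¬b
    contradiction : Dec (dz < dj) → ⊥
    contradiction (yes dz<dj) = <-irrefl refl (begin-strict
      #nonLeft dz              <⟨ count-step _ 1 dz (¬Below⇒nonLeft ¬b) ⟩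
      #nonLeft (suc dz)        ≤⟨ count-monoʳ _ 1 dz<dj ⟩
      #nonLeft dj              ≡⟨ balanced ⟨
      #nonRight di             ≤⟨ count-monoʳ _ 1 (≤-pred i≤z) ⟩
      #nonRight dz             ≡⟨ z-balanced ⟩
      #nonLeft dz              ∎)
      where open ≤-Reasoning
    contradiction (no dz≮dj) = <-irrefl refl (begin-strict
      #nonRight di             <⟨ count-step _ 1 di nri ⟩
      #nonRight (suc di)       ≤⟨ count-monoʳ _ 1 (subst (suc di ≤_) (sym dz≡dj) (≤-pred i<j)) ⟩
      #nonRight dz             ≡⟨ z-balanced ⟩
      #nonLeft dz              ≤⟨ count-monoʳ _ 1 (≤-pred z≤j) ⟩
      #nonLeft dj              ≡⟨ balanced ⟨
      #nonRight di             ∎)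
      where
      open ≤-Reasoning
      dz≡dj = ≤-antisym (≤-pred z≤j) (≮⇒≥ dz≮dj)

-- Windows of covered points

inPoset? : ∀ m i j → Dec (InPoset m i j)
inPoset? m i j with 1 ≤? i | i ≤? j | j ≤? m
... | yes a | yes b | yes c = yes (a , b , c)
... | no ¬a | _     | _     = no (¬a ∘ proj₁)
... | _     | no ¬b | _     = no (¬b ∘ proj₁ ∘ proj₂)
... | _     | _     | no ¬c = no (¬c ∘ proj₂ ∘ proj₂)

does-true⁻ : ∀ {P : Set} (p? : Dec P) → does p? ≡ true → P
does-true⁻ (yes p) _ = p

-- The part of S strictly inside the window [o + 1 , o + m + 1], read as a subset of A^m
-- via [i , j] ↦ [o + i , o + j + 1]; ranks drop by one.
window : ℕ → ℕ → IntSet → IntSet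
window m o S i j = does (inPoset? m i j) ∧ S (o + i) (suc (o + j))

window⊆ : ∀ m o S {i j} → window m o S i j ≡ true → InPoset m i j × S (o + i) (suc (o + j)) ≡ true
window⊆ m o S {i} {j} e =
  let inside , Sij = ∧-true⁻ {does (inPoset? m i j)} e in does-true⁻ (inPoset? m i j) inside , Sij

window⁺ : ∀ m o S {i j} → InPoset m i j → S (o + i) (suc (o + j)) ≡ true → window m o S i j ≡ true
window⁺ m o S {i} {j} ij∈ Sij = ∧-true⁺ (dec-true (inPoset? m i j) ij∈) Sij

window-inside : ∀ m o S {i j} → InPoset m i j → window m o S i j ≡ S (o + i) (suc (o + j))
window-inside m o S {i} {j} ij∈ rewrite dec-true (inPoset? m i j) ij∈ = refl

window-outside : ∀ m o S {i j} → ¬ InPoset m i j → window m o S i j ≡ false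
window-outside m o S {i} {j} ij∉ rewrite dec-false (inPoset? m i j) ij∉ = refl

Comparable-shift⁺ : ∀ o {i j k l} → Comparable (i , j) (k , l) →
                    Comparable (o + i , suc (o + j)) (o + k , suc (o + l))
Comparable-shift⁺ o (inj₁ (k≤i , j≤l)) = inj₁ (+-monoʳ-≤ o k≤i , s≤s (+-monoʳ-≤ o j≤l))
Comparable-shift⁺ o (inj₂ (i≤k , l≤j)) = inj₂ (+-monoʳ-≤ o i≤k , s≤s (+-monoʳ-≤ o l≤j))

Comparable-shift⁻ : ∀ o {i j k l} → Comparable (o + i , suc (o + j)) (o + k , suc (o + l)) →
                    Comparable (i , j) (k , l)
Comparable-shift⁻ o (inj₁ (k≤i , j≤l)) = inj₁ (+-cancelˡ-≤ o _ _ k≤i , +-cancelˡ-≤ o _ _ (≤-pred j≤l))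
Comparable-shift⁻ o (inj₂ (i≤k , l≤j)) = inj₂ (+-cancelˡ-≤ o _ _ i≤k , +-cancelˡ-≤ o _ _ (≤-pred l≤j))

InRank-shift⁺ : ∀ {n m o k i j} → suc (o + m) ≤ n → InRank m k i j → InRank n (suc k) (o + i) (suc (o + j))
InRank-shift⁺ {n} {m} {o} {k} {i} fits (1≤i , i+k≤m , refl) =
  ≤-trans 1≤i (m≤n+m i o) ,
  ≤-trans (≤-reflexive (+-suc (o + i) k))
          (≤-trans (s≤s (≤-trans (≤-reflexive (+-assoc o i k)) (+-monoʳ-≤ o i+k≤m))) fits) ,
  trans (cong suc (sym (+-assoc o i k))) (sym (+-suc (o + i) k))

InRank-shift⁻ : ∀ {n m o k i j} → 1 ≤ i → j ≤ m → InRank n (suc k) (o + i) (suc (o + j)) → InRank m k i j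
InRank-shift⁻ {o = o} {k} {i} {j} 1≤i j≤m (_ , _ , e) = 1≤i , subst (_≤ _) j≡i+k j≤m , j≡i+k
  where
  j≡i+k : j ≡ i + k
  j≡i+k = +-cancelˡ-≡ o _ _ (trans (suc-injective (trans e (+-suc (o + i) k))) (+-assoc o i k))

-- The points o and o + m + 2 act as walls: no other element of S is comparable with an interval
-- inside the window unless it lies inside the window too.
record WindowInv (n m o : ℕ) (S : IntSet) : Set where
  field
    antichain : IsAntichain n S
    fits      : suc (o + m) ≤ n
    leftWall  : 1 ≤ o → S o o ≡ true
    rightWall : suc (o + m) < n → S (suc (suc (o + m))) (suc (suc (o + m))) ≡ true
    noPoints  : ∀ x → o < x → x ≤ suc (o + m) → S x x ≡ false

module Window {n m o S} (inv : WindowInv n m o S) where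
  open WindowInv inv

  private
    b = suc (o + m)
    S⊆ = proj₁ antichain
    S-anti = proj₂ antichain

  comparable-inside : ∀ {i j k l} → o < i → i < j → j ≤ b → S k l ≡ true → Comparable (i , j) (k , l) →
                      o < k × k < l × l ≤ b
  comparable-inside {i} {j} {k} {l} o<i i<j j≤b Skl (inj₂ (i≤k , l≤j)) =
    o<k , ≤∧≢⇒< (proj₁ (proj₂ (S⊆ k l Skl))) k≢l , ≤-trans l≤j j≤b
    where
    o<k = <-≤-trans o<i i≤k
    k≢l : k ≢ l
    k≢l refl = true≢false (trans (sym Skl) (noPoints k o<k (≤-trans l≤j j≤b)))
  comparable-inside {i} {j} {k} {l} o<i i<j j≤b Skl (inj₁ (k≤i , j≤l)) =
    o<k , <-≤-trans (≤-<-trans k≤i i<j) j≤l , l≤b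
    where
    o<l = <-≤-trans (<-trans o<i i<j) j≤l
    o<k : o < k
    o<k with o <? k
    ... | yes o<k = o<k
    ... | no o≮k = let k≤o = ≮⇒≥ o≮k in ⊥-elim (
      <-irrefl (proj₂ (S-anti o o k l (leftWall (≤-trans (proj₁ (S⊆ k l Skl)) k≤o)) Skl k≤o (<⇒≤ o<l))) o<l)
    l≤b : l ≤ b
    l≤b with l ≤? b
    ... | yes l≤b = l≤b
    ... | no l≰b = let b<l = ≰⇒> l≰b in ⊥-elim (
      <-irrefl (sym (proj₁ (S-anti (suc b) (suc b) k l (rightWall (<-≤-trans b<l (proj₂ (proj₂ (S⊆ k l Skl))))) Skl
                                   (≤-trans k≤i (≤-trans (<⇒≤ i<j) (m≤n⇒m≤1+n j≤b))) b<l)))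
               (≤-<-trans k≤i (<-≤-trans i<j (m≤n⇒m≤1+n j≤b))))

  canAdd-window : ∀ {i j} → InPoset m i j → canAdd n S (o + i , suc (o + j)) ≡ canAdd m (window m o S) (i , j)
  canAdd-window {i} {j} (1≤i , i≤j , j≤m) = bool-ext to from
    where
    o<o+i : o < o + i
    o<o+i = m<m+n o 1≤i
    to : canAdd n S (o + i , suc (o + j)) ≡ true → canAdd m (window m o S) (i , j) ≡ true
    to free = canAdd-true⁺ m (window m o S) (i , j) λ k l _ Wkl c →
      let _ , Skl = window⊆ m o S Wkl in
      canAdd-true⁻ n S _ free _ _ (S⊆ _ _ Skl) Skl (Comparable-shift⁺ o c)
    from : canAdd m (window m o S) (i , j) ≡ true → canAdd n S (o + i , suc (o + j)) ≡ true
    from free = canAdd-true⁺ n S _ λ k l _ Skl c → clash k l Skl c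
      (comparable-inside o<o+i (s≤s (+-monoʳ-≤ o i≤j)) (s≤s (+-monoʳ-≤ o j≤m)) Skl c)
      where
      clash : ∀ k l → S k l ≡ true → Comparable (o + i , suc (o + j)) (k , l) → o < k × k < l × l ≤ b → ⊥
      clash k l Skl c (o<k , k<l , l≤b)
        with k′ , refl ← m≤n⇒∃[o]m+o≡n (<⇒≤ o<k) | l′ , refl ← m≤n⇒∃[o]m+o≡n (≤-trans o<k (<⇒≤ k<l))
        = canAdd-true⁻ m (window m o S) (i , j) free k′ l′ kl∈ (window⁺ m o S kl∈ Skl) (Comparable-shift⁻ o c)
        where
        kl∈ : InPoset m k′ l′
        kl∈ = m<m+n⇒0<n o o<k , +-cancelˡ-≤ o _ _ (≤-pred k<l) , +-cancelˡ-≤ o _ _ (≤-pred l≤b)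

  toggleRank-window : ∀ k → window m o (toggleRank n (suc k) S) ≐ toggleRank m k (window m o S)
  toggleRank-window k i j = byPosition (inPoset? m i j)
    where
    open ≡-Reasoning
    byPosition : Dec (InPoset m i j) → window m o (toggleRank n (suc k) S) i j ≡ toggleRank m k (window m o S) i j
    byPosition (no ij∉) =
      trans (window-outside m o (toggleRank n (suc k) S) ij∉)
            (sym (trans (toggleRank-off m k (window m o S) i j (ij∉ ∘ InRank⇒InPoset)) (window-outside m o S ij∉)))
    byPosition (yes ij∈@(1≤i , _ , j≤m)) with inRank? m k i j
    ... | yes r = begin
          window m o (toggleRank n (suc k) S) i j
            ≡⟨ window-inside m o (toggleRank n (suc k) S) ij∈ ⟩
          toggleRank n (suc k) S (o + i) (suc (o + j))
            ≡⟨ toggleRank-on n (suc k) S _ _ (InRank-shift⁺ fits r) ⟩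
          not (S (o + i) (suc (o + j))) ∧ canAdd n S (o + i , suc (o + j))
            ≡⟨ cong₂ (λ a c → not a ∧ c) (sym (window-inside m o S ij∈)) (canAdd-window ij∈) ⟩
          not (window m o S i j) ∧ canAdd m (window m o S) (i , j)
            ≡⟨ toggleRank-on m k (window m o S) i j r ⟨
          toggleRank m k (window m o S) i j ∎
    ... | no ¬r = begin
          window m o (toggleRank n (suc k) S) i j
            ≡⟨ window-inside m o (toggleRank n (suc k) S) ij∈ ⟩
          toggleRank n (suc k) S (o + i) (suc (o + j))
            ≡⟨ toggleRank-off n (suc k) S _ _ (¬r ∘ InRank-shift⁻ 1≤i j≤m) ⟩
          S (o + i) (suc (o + j))
            ≡⟨ window-inside m o S ij∈ ⟨
          window m o S i j
            ≡⟨ toggleRank-off m k (window m o S) i j ¬r ⟨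
          toggleRank m k (window m o S) i j ∎

  toggleRank-WindowInv : ∀ k → WindowInv n m o (toggleRank n (suc k) S)
  toggleRank-WindowInv k = record
    { antichain = toggleRank-antichain n (suc k) S antichain
    ; fits      = fits
    ; leftWall  = λ 1≤o → trans (fixesPoint o) (leftWall 1≤o)
    ; rightWall = λ b<n → trans (fixesPoint _) (rightWall b<n)
    ; noPoints  = λ x o<x x≤b → trans (fixesPoint x) (noPoints x o<x x≤b)
    }
    where
    fixesPoint : ∀ x → toggleRank n (suc k) S x x ≡ S x x
    fixesPoint x = toggleRank-off n (suc k) S x x (diagonal∉InRank (s≤s z≤n))

upFrom-window : ∀ {n m o} c s S → WindowInv n m o S →
                window m o (upFrom n (suc s) c S) ≐ upFrom m s c (window m o S) ×
                WindowInv n m o (upFrom n (suc s) c S)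
upFrom-window zero s S inv = (λ _ _ → refl) , inv
upFrom-window {m = m} (suc c) s S inv
  with eq , inv′ ← upFrom-window c (suc s) _ (Window.toggleRank-WindowInv inv s) =
  ≐-trans eq (upFrom-cong m (suc s) c (Window.toggleRank-window inv s)) , inv′

toggleRank-beyond : ∀ m k X → m ≤ k → toggleRank m k X ≐ X
toggleRank-beyond m k X m≤k i j = toggleRank-off m k X i j λ (1≤i , i+k≤m , _) →
  <⇒≱ (m<n+m k 1≤i) (≤-trans i+k≤m m≤k)

upFrom-beyond : ∀ m s c X → m ≤ s → upFrom m s c X ≐ X
upFrom-beyond m s zero    X m≤s = λ _ _ → refl
upFrom-beyond m s (suc c) X m≤s =
  ≐-trans (upFrom-beyond m (suc s) c _ (m≤n⇒m≤1+n m≤s)) (toggleRank-beyond m s X m≤s)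

rvacAux-beyond : ∀ m s c X → m ≤ s → rvacAux m s c X ≐ X
rvacAux-beyond m s zero    X m≤s = λ _ _ → refl
rvacAux-beyond m s (suc c) X m≤s =
  ≐-trans (rvacAux-beyond m (suc s) c _ (m≤n⇒m≤1+n m≤s)) (upFrom-beyond m s (suc (rk m) ∸ s) X m≤s)

∸-suc : ∀ {s m} → s < m → m ∸ s ≡ suc (m ∸ suc s)
∸-suc {zero}  {suc m} _         = refl
∸-suc {suc s} {suc m} (s≤s s<m) = ∸-suc s<m

upFrom-tail : ∀ m s c X → m ≤ s + c → upFrom m s c X ≐ upFrom m s (m ∸ s) X
upFrom-tail m s c X m≤s+c with s <? m
upFrom-tail m s zero    X m≤s   | yes s<m = ⊥-elim (<⇒≱ s<m (subst (m ≤_) (+-identityʳ s) m≤s))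
upFrom-tail m s (suc c) X m≤s+c | yes s<m =
  ≐-trans (upFrom-tail m (suc s) c (toggleRank m s X) (subst (m ≤_) (+-suc s c) m≤s+c))
          (λ i j → cong (λ c′ → upFrom m s c′ X i j) (sym (∸-suc s<m)))
upFrom-tail m s c       X _     | no s≮m rewrite m≤n⇒m∸n≡0 (≮⇒≥ s≮m) = upFrom-beyond m s c X (≮⇒≥ s≮m)

rvacAux-tail : ∀ m s c X → m ≤ s + c → rvacAux m s c X ≐ rvacAux m s (m ∸ s) X
rvacAux-tail m s c X m≤s+c with s <? m
rvacAux-tail m s zero    X m≤s   | yes s<m = ⊥-elim (<⇒≱ s<m (subst (m ≤_) (+-identityʳ s) m≤s))
rvacAux-tail m s (suc c) X m≤s+c | yes s<m =
  ≐-trans (rvacAux-tail m (suc s) c _ (subst (m ≤_) (+-suc s c) m≤s+c))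
          (λ i j → cong (λ c′ → rvacAux m s c′ X i j) (sym (∸-suc s<m)))
rvacAux-tail m s c       X _     | no s≮m rewrite m≤n⇒m∸n≡0 (≮⇒≥ s≮m) = rvacAux-beyond m s c X (≮⇒≥ s≮m)

rvacAux-window : ∀ {n m o} c s S → WindowInv n (suc m) o S → suc m ≤ rk n →
                 window (suc m) o (rvacAux n (suc s) c S) ≐ rvacAux (suc m) s c (window (suc m) o S)
rvacAux-window zero s S inv m<r = λ _ _ → refl
rvacAux-window {n} {m} (suc c) s S inv m<r with eq , inv′ ← upFrom-window (rk n ∸ s) s S inv =
  ≐-trans (rvacAux-window c (suc s) _ inv′ m<r)
          (rvacAux-cong (suc m) (suc s) c
             (≐-trans eq (upFrom-tail (suc m) s (rk n ∸ s) _ (≤-trans m<r (m≤n+m∸n (rk n) s)))))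

rvac-window : ∀ {r m o} A → WindowInv (suc r) (suc m) o (rowmotion (suc r) A) → suc m ≤ r →
              window (suc m) o (rvac (suc r) A) ≐ rvac (suc m) (window (suc m) o (rowmotion (suc r) A))
rvac-window {r} {m} A inv m<r =
  ≐-trans (rvacAux-window r 0 (rowmotion (suc r) A) inv m<r) (rvacAux-tail (suc m) 0 r _ m<r)

window-antichain : ∀ {n m o S} → IsAntichain n S → IsAntichain m (window m o S)
window-antichain {m = m} {o} {S} (_ , S-anti) = (λ i j e → proj₁ (window⊆ m o S e)) , W-anti
  where
  W-anti : ∀ i j k l → window m o S i j ≡ true → window m o S k l ≡ true → k ≤ i → j ≤ l → (i ≡ k) × (j ≡ l)
  W-anti i j k l e₁ e₂ k≤i j≤l =
    let i≡k , j≡l = S-anti _ _ _ _ (proj₂ (window⊆ m o S e₁)) (proj₂ (window⊆ m o S e₂))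
                           (+-monoʳ-≤ o k≤i) (s≤s (+-monoʳ-≤ o j≤l))
    in +-cancelˡ-≡ o _ _ i≡k , +-cancelˡ-≡ o _ _ (suc-injective j≡l)

module _ {P : ℕ → Set} (P? : ∀ x → Dec (P x)) where

  crossing : ∀ a d → P a → ¬ P (a + d) → ∃[ x ] (a ≤ x × x < a + d × P x × ¬ P (suc x))
  crossing a zero    pa ¬pa = ⊥-elim (¬pa (subst P (sym (+-identityʳ a)) pa))
  crossing a (suc d) pa ¬pe with P? (suc a)
  ... | no ¬pa+1 = a , ≤-refl , m<m+n a z<s , pa , ¬pa+1
  ... | yes pa+1 with x , a<x , x<e , px , ¬px+1 ← crossing (suc a) d pa+1 (subst (¬_ ∘ P) (+-suc a d) ¬pe) =
    x , <⇒≤ a<x , subst (x <_) (sym (+-suc a d)) x<e , px , ¬px+1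

  allOrCounterexample : ∀ a len → (∀ z → a ≤ z → z < a + len → P z) ⊎ ∃[ z ] (a ≤ z × z < a + len × ¬ P z)
  allOrCounterexample a zero = inj₁ λ z a≤z z<a → ⊥-elim (<⇒≱ (subst (z <_) (+-identityʳ a) z<a) a≤z)
  allOrCounterexample a (suc len) with P? a | allOrCounterexample (suc a) len
  ... | no ¬pa | _ = inj₂ (a , ≤-refl , m<m+n a z<s , ¬pa)
  ... | yes _  | inj₂ (z , a<z , z<e , ¬pz) = inj₂ (z , <⇒≤ a<z , subst (z <_) (sym (+-suc a len)) z<e , ¬pz)
  ... | yes pa | inj₁ all = inj₁ λ z a≤z z<e → case a ≟ z of λ where
    (yes refl) → pa
    (no a≢z)   → all z (≤∧≢⇒< a≤z a≢z) (subst (z <_) (+-suc a len) z<e)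

  lastGap : ∀ k → ∃[ o ] (o ≤ k × (1 ≤ o → ¬ P o) × (∀ x → o < x → x ≤ k → P x))
  lastGap zero = 0 , z≤n , (λ ()) , λ x 0<x x≤0 → ⊥-elim (<⇒≱ 0<x x≤0)
  lastGap (suc k) with P? (suc k)
  ... | no ¬p = suc k , ≤-refl , (λ _ → ¬p) , λ x k<x x≤k → ⊥-elim (<⇒≱ k<x x≤k)
  ... | yes p with o , o≤k , gap , run ← lastGap k =
    o , m≤n⇒m≤1+n o≤k , gap , λ x o<x x≤k+1 → case x ≟ suc k of λ where
      (yes refl) → p
      (no x≢)    → run x o<x (≤-pred (≤∧≢⇒< x≤k+1 x≢))

  firstGap : ∀ d j → ∃[ b ] (j ≤ b × b ≤ j + d × (b < j + d → ¬ P (suc b)) × (∀ x → j < x → x ≤ b → P x))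
  firstGap zero j = j , ≤-refl , m≤m+n j 0 ,
    (λ j<j+0 → ⊥-elim (<-irrefl (sym (+-identityʳ j)) j<j+0)) , λ x j<x x≤j → ⊥-elim (<⇒≱ j<x x≤j)
  firstGap (suc d) j with P? (suc j)
  ... | no ¬p = j , ≤-refl , m≤m+n j (suc d) , (λ _ → ¬p) , λ x j<x x≤j → ⊥-elim (<⇒≱ j<x x≤j)
  ... | yes p with b , j<b , b≤e , gap , run ← firstGap d (suc j) =
    b , <⇒≤ j<b , subst (b ≤_) (sym (+-suc j d)) b≤e , (λ b<e → gap (subst (b <_) (+-suc j d) b<e)) ,
    λ x j<x x≤b → case suc j ≟ x of λ where
      (yes refl) → p
      (no ≢x)    → run x (≤∧≢⇒< j<x ≢x) x≤b

record CoveredRun (n : ℕ) (A : IntSet) (o m : ℕ) : Set where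
  field
    fits     : suc (o + m) ≤ n
    leftGap  : 1 ≤ o → ¬ Below A o o
    rightGap : suc (o + m) < n → ¬ Below A (suc (suc (o + m))) (suc (suc (o + m)))
    covered  : ∀ x → o < x → x ≤ suc (o + m) → Below A x x

module CoveredWindow {n A} (anti : IsAntichain n A) {o m} (run : CoveredRun n A o m) where
  open CoveredRun run
  open AntichainCounting anti using (A⊆; ends-ordered; leftEnd-unique)

  private
    b = suc (o + m)
    R = rowmotion n A
    B = window m o R

  rowmotion-WindowInv : WindowInv n m o R
  rowmotion-WindowInv = record
    { antichain = upFrom-antichain n 0 n A anti
    ; fits      = fits
    ; leftWall  = λ 1≤o →
        rowmotion⁺ A⊆ ((1≤o , ≤-refl , ≤-trans (m≤n⇒m≤1+n (m≤m+n o m)) fits) , leftGap 1≤o , inj₁ refl)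
    ; rightWall = λ b<n → rowmotion⁺ A⊆ ((s≤s z≤n , ≤-refl , b<n) , rightGap b<n , inj₁ refl)
    ; noPoints  = λ x o<x x≤b → ≢true⇒≡false λ Rxx → proj₁ (proj₂ (rowmotion⁻ A⊆ Rxx)) (covered x o<x x≤b)
    }

  B-antichain : IsAntichain m B
  B-antichain = window-antichain (WindowInv.antichain rowmotion-WindowInv)

  meets⇒inside : ∀ {u w x} → A u w ≡ true → u ≤ x → x ≤ w → o < x → x ≤ b → o < u × w ≤ b
  meets⇒inside {u} {w} {x} Auw u≤x x≤w o<x x≤b with o <? u | w ≤? b
  ... | yes o<u | yes w≤b = o<u , w≤b
  ... | no o≮u | _ =
    ⊥-elim (leftGap (≤-trans (proj₁ (A⊆ u w Auw)) (≮⇒≥ o≮u)) (u , w , Auw , ≮⇒≥ o≮u , <⇒≤ (<-≤-trans o<x x≤w)))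
  ... | _ | no w≰b = ⊥-elim (rightGap (<-≤-trans (≰⇒> w≰b) (proj₂ (proj₂ (A⊆ u w Auw))))
                                     (u , w , Auw , ≤-trans u≤x (m≤n⇒m≤1+n x≤b) , ≰⇒> w≰b))

  ¬Below-leftExtension : ∀ {x v} → A (suc x) v ≡ true → ¬ Below A x v
  ¬Below-leftExtension {x} {v} Ax+1v (u , w , Auw , u≤x , v≤w) =
    <-irrefl (sym (proj₁ (proj₂ anti (suc x) v u w Ax+1v Auw (m≤n⇒m≤1+n u≤x) v≤w))) (s≤s u≤x)

  ¬Below-rightExtension : ∀ {u x} → A u x ≡ true → ¬ Below A u (suc x)
  ¬Below-rightExtension {u} {x} Aux (u′ , w , Au′w , u′≤u , x<w) =
    <-irrefl (proj₂ (proj₂ anti u x u′ w Aux Au′w u′≤u (<⇒≤ x<w))) x<w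

  rightEnd-before-cover : ∀ {u′ x u w} → A u′ x ≡ true → A u w ≡ true → x < w → u′ < u
  rightEnd-before-cover {u′} {x} {u} Au′x Auw x<w with <-cmp u′ u
  ... | tri< u′<u _ _ = u′<u
  ... | tri≈ _ refl _ = ⊥-elim (<-irrefl (leftEnd-unique Au′x Auw) x<w)
  ... | tri> _ _ u<u′ = ⊥-elim (<-irrefl refl (<-trans (ends-ordered Auw Au′x u<u′) x<w))

  R⁺ : ∀ {x y} → MinNotBelow n A x y → R x y ≡ true
  R⁺ = rowmotion⁺ A⊆

  R⁻ : ∀ {x y} → R x y ≡ true → MinNotBelow n A x y
  R⁻ = rowmotion⁻ A⊆

  window-leftEnd : ∀ {x′} → 1 ≤ x′ → x′ ≤ m → isLeftEnd m B x′ ≡ isLeftEnd n A (suc (o + x′))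
  window-leftEnd {x′} 1≤x′ x′≤m = bool-ext to from
    where
    x = o + x′
    o<x : o < x
    o<x = m<m+n o 1≤x′

    leftEndAbove : ∀ {y} → x < y → MinNotBelow n A x y → isLeftEnd n A (suc x) ≡ true
    leftEndAbove x<y (_ , ¬b , inj₁ x≡y) = ⊥-elim (<-irrefl x≡y x<y)
    leftEndAbove x<y (_ , ¬b , inj₂ ((u , w , Auw , u≤x+1 , y≤w) , _)) with u ≟ suc x
    ... | yes refl = isLeftEnd⁺ A⊆ Auw
    ... | no u≢ = ⊥-elim (¬b (u , w , Auw , ≤-pred (≤∧≢⇒< u≤x+1 u≢) , y≤w))

    to : isLeftEnd m B x′ ≡ true → isLeftEnd n A (suc x) ≡ true
    to e with w′ , Bx′w′ ← isLeftEnd⁻ m B x′ e with (_ , x′≤w′ , _) , Rxy ← window⊆ m o R Bx′w′ =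
      leftEndAbove (s≤s (+-monoʳ-≤ o x′≤w′)) (R⁻ Rxy)

    leftEndFrom : ∀ {v w} → A (suc x) v ≡ true → x ≤ w →
                  ∃[ z ] (w ≤ z × z < v × Below A x z × ¬ Below A x (suc z)) → isLeftEnd m B x′ ≡ true
    leftEndFrom {v} Ax+1v x≤w (z , w≤z , z<v , b-z , ¬b-z+1)
      with z′ , refl ← m≤n⇒∃[o]m+o≡n (≤-trans (<⇒≤ o<x) (≤-trans x≤w w≤z))
      = isLeftEnd⁺ (proj₁ B-antichain) (window⁺ m o R z∈ (R⁺ minimal))
      where
      x+1≤v = proj₁ (proj₂ (A⊆ _ _ Ax+1v))
      v≤b = proj₂ (meets⇒inside Ax+1v ≤-refl x+1≤v (<-trans o<x (n<1+n x)) (s≤s (+-monoʳ-≤ o x′≤m)))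
      minimal : MinNotBelow n A x (suc (o + z′))
      minimal = (≤-trans 1≤x′ (m≤n+m x′ o) , m≤n⇒m≤1+n (≤-trans x≤w w≤z) ,
                 ≤-trans z<v (proj₂ (proj₂ (A⊆ _ _ Ax+1v)))) ,
                ¬b-z+1 , inj₂ ((suc x , v , Ax+1v , ≤-refl , z<v) , b-z)
      z∈ : InPoset m x′ z′
      z∈ = 1≤x′ , +-cancelˡ-≤ o _ _ (≤-trans x≤w w≤z) , +-cancelˡ-≤ o _ _ (≤-pred (≤-trans z<v v≤b))

    from : isLeftEnd n A (suc x) ≡ true → isLeftEnd m B x′ ≡ true
    from e with v , Ax+1v ← isLeftEnd⁻ n A (suc x) e
      with u , w , Auw , u≤x , x≤w ← covered x o<x (m≤n⇒m≤1+n (+-monoʳ-≤ o x′≤m))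
      with d , refl ← m≤n⇒∃[o]m+o≡n (<⇒≤ (ends-ordered Auw Ax+1v (s≤s u≤x)))
      = leftEndFrom Ax+1v x≤w
          (crossing (below? A⊆ x) w d (u , w , Auw , u≤x , ≤-refl) (¬Below-leftExtension Ax+1v))

  window-rightEnd : ∀ {y′} → 1 ≤ y′ → y′ ≤ m → isRightEnd m B y′ ≡ isRightEnd n A (o + y′)
  window-rightEnd {y′} 1≤y′ y′≤m = bool-ext to from
    where
    y = suc (o + y′)
    y≤b : y ≤ b
    y≤b = s≤s (+-monoʳ-≤ o y′≤m)

    rightEndBelow : ∀ {x} → x < y → MinNotBelow n A x y → isRightEnd n A (o + y′) ≡ true
    rightEndBelow x<y (_ , ¬b , inj₁ x≡y) = ⊥-elim (<-irrefl x≡y x<y)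
    rightEndBelow x<y (_ , ¬b , inj₂ (_ , (u , w , Auw , u≤x , y-1≤w))) with w ≟ o + y′
    ... | yes refl = isRightEnd⁺ A⊆ Auw
    ... | no w≢ = ⊥-elim (¬b (u , w , Auw , u≤x , ≤∧≢⇒< y-1≤w (w≢ ∘ sym)))

    to : isRightEnd m B y′ ≡ true → isRightEnd n A (o + y′) ≡ true
    to e with u′ , Bu′y′ ← isRightEnd⁻ m B y′ e with (_ , u′≤y′ , _) , Rxy ← window⊆ m o R Bu′y′ =
      rightEndBelow (s≤s (+-monoʳ-≤ o u′≤y′)) (R⁻ Rxy)

    rightEnd-inside : ∀ {u′} → A u′ (o + y′) ≡ true → o < u′
    rightEnd-inside Au′ =
      proj₁ (meets⇒inside Au′ (proj₁ (proj₂ (A⊆ _ _ Au′))) ≤-refl (m<m+n o 1≤y′) (m≤n⇒m≤1+n (+-monoʳ-≤ o y′≤m)))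

    rightEndFrom : ∀ {u′ u w} → A u′ (o + y′) ≡ true → A u w ≡ true → u ≤ y → y ≤ w →
                   ∃[ x ] (u′ ≤ x × x < u × ¬ Below A x y × ¬ ¬ Below A (suc x) y) → isRightEnd m B y′ ≡ true
    rightEndFrom {u′} Au′ Auw u≤y y≤w (x , u′≤x , x<u , ¬b-x , ¬¬b-x+1)
      with x″ , refl ← m≤n⇒∃[o]m+o≡n (<⇒≤ (<-≤-trans (rightEnd-inside Au′) u′≤x))
      = isRightEnd⁺ (proj₁ B-antichain) (window⁺ m o R x∈ (R⁺ minimal))
      where
      o<u′ = rightEnd-inside Au′
      minimal : MinNotBelow n A (o + x″) y
      minimal = (≤-trans (s≤s z≤n) (<-≤-trans o<u′ u′≤x) , <⇒≤ (<-≤-trans x<u u≤y) ,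
                 ≤-trans y≤w (proj₂ (proj₂ (A⊆ _ _ Auw)))) ,
                ¬b-x , inj₂ (decidable-stable (below? A⊆ _ y) ¬¬b-x+1 , (u′ , o + y′ , Au′ , u′≤x , ≤-refl))
      x∈ : InPoset m x″ y′
      x∈ = m<m+n⇒0<n o (<-≤-trans o<u′ u′≤x) , +-cancelˡ-≤ o _ _ (≤-pred (<-≤-trans x<u u≤y)) , y′≤m

    from : isRightEnd n A (o + y′) ≡ true → isRightEnd m B y′ ≡ true
    from e with u′ , Au′ ← isRightEnd⁻ n A (o + y′) e
      with u , w , Auw , u≤y , y≤w ← covered y (m<n⇒m<1+n (m<m+n o 1≤y′)) y≤b
      with d , refl ← m≤n⇒∃[o]m+o≡n (<⇒≤ (rightEnd-before-cover Au′ Auw y≤w))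
      = rightEndFrom Au′ Auw u≤y y≤w
          (crossing (¬? ∘ λ x → below? A⊆ x y) u′ d (¬Below-rightExtension Au′)
                    (λ ¬b → ¬b (u′ + d , w , Auw , ≤-refl , y≤w)))

  open AntichainCounting anti using (#nonRight; #nonLeft; ¬straddles⇒balanced)

  leftEnd-o+1 : isLeftEnd n A (suc o) ≡ true
  leftEnd-o+1 with u , w , Auw , u≤o+1 , o+1≤w ← covered (suc o) ≤-refl (s≤s (m≤m+n o m))
    with o<u , _ ← meets⇒inside Auw u≤o+1 o+1≤w ≤-refl (s≤s (m≤m+n o m))
    rewrite ≤-antisym u≤o+1 o<u = isLeftEnd⁺ A⊆ Auw

  balanced-o : #nonRight o ≡ #nonLeft o
  balanced-o = ¬straddles⇒balanced o λ (u , w , Auw , u<o+1 , o+1≤w) →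
    leftGap (≤-trans (proj₁ (A⊆ u w Auw)) (≤-pred u<o+1)) (u , w , Auw , ≤-pred u<o+1 , <⇒≤ o+1≤w)

  #nonRight-window : ∀ di → di < m → #nonRight (o + di) ≡ #nonLeft o + count (nonRight m B) 1 di
  #nonRight-window di di<m = begin
    #nonRight (o + di)                            ≡⟨ count-++ (nonRight n A) 1 o di ⟩
    #nonRight o + count (nonRight n A) (suc o) di ≡⟨ cong₂ _+_ balanced-o (sym shifted) ⟩
    #nonLeft o + count (nonRight m B) 1 di        ∎
    where
    open ≡-Reasoning
    shifted : count (nonRight m B) 1 di ≡ count (nonRight n A) (suc o) di
    shifted = trans (count-cong 1 di λ z 1≤z z<1+di →
                       trans (cong not (window-rightEnd 1≤z (≤-trans (≤-pred z<1+di) (<⇒≤ di<m))))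
                             (cong (nonRight n A) (+-comm o z)))
                    (count-shift (nonRight n A) o 1 di)

  #nonLeft-window : ∀ dj → dj < m → #nonLeft (o + suc dj) ≡ #nonLeft o + count (nonLeft m B) 1 dj
  #nonLeft-window dj dj<m = begin
    #nonLeft (o + suc dj)
      ≡⟨ count-++ (nonLeft n A) 1 o (suc dj) ⟩
    #nonLeft o + (ind (nonLeft n A (suc o)) + count (nonLeft n A) (2 + o) dj)
      ≡⟨ cong (λ b → #nonLeft o + (ind (not b) + count (nonLeft n A) (2 + o) dj)) leftEnd-o+1 ⟩
    #nonLeft o + count (nonLeft n A) (2 + o) dj
      ≡⟨ cong (#nonLeft o +_) (sym shifted) ⟩
    #nonLeft o + count (nonLeft m B) 1 dj
      ∎
    where
    open ≡-Reasoning
    shifted : count (nonLeft m B) 1 dj ≡ count (nonLeft n A) (2 + o) dj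
    shifted = trans (count-cong 1 dj λ z 1≤z z<1+dj →
                       trans (cong not (window-leftEnd 1≤z (≤-trans (≤-pred z<1+dj) (<⇒≤ dj<m))))
                             (cong (nonLeft n A) (trans (cong suc (+-comm o z)) (sym (+-suc z o)))))
                    (count-shift (nonLeft n A) (suc o) 1 dj)

  window-LK : ∀ {di dj} → di < m → dj < m →
              LK m B (suc di) (suc dj) ≡ LK n A (o + suc di) (suc (o + suc dj))
  window-LK {di} {dj} di<m dj<m = bool-ext to from
    where
    o+1+di≡ : o + suc di ≡ suc (o + di)
    o+1+di≡ = +-suc o di
    nonRight≡ : nonRight m B (suc di) ≡ nonRight n A (suc (o + di))
    nonRight≡ = cong not (trans (window-rightEnd (s≤s z≤n) di<m) (cong (isRightEnd n A) o+1+di≡))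
    nonLeft≡ : nonLeft m B (suc dj) ≡ nonLeft n A (suc (o + suc dj))
    nonLeft≡ = cong not (window-leftEnd (s≤s z≤n) dj<m)

    to : LK m B (suc di) (suc dj) ≡ true → LK n A (o + suc di) (suc (o + suc dj)) ≡ true
    to e with _ , _ , refl , refl , lkPair _ _ nri nlj balanced ← LK-true⁻ m B (suc di) (suc dj) e
      rewrite o+1+di≡ =
      LK-true⁺ (lkPair (<-≤-trans (m<n⇒m<1+n (+-monoʳ-< o di<m)) fits) (≤-trans (s≤s (+-monoʳ-≤ o dj<m)) fits)
                       (trans (sym nonRight≡) nri)
                       (trans (sym nonLeft≡) nlj)
                       (begin
                         #nonRight (o + di)                    ≡⟨ #nonRight-window di di<m ⟩
                         #nonLeft o + count (nonRight m B) 1 di ≡⟨ cong (#nonLeft o +_) balanced ⟩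
                         #nonLeft o + count (nonLeft m B) 1 dj  ≡⟨ #nonLeft-window dj dj<m ⟨
                         #nonLeft (o + suc dj)                 ∎))
      where open ≡-Reasoning

    from : LK n A (o + suc di) (suc (o + suc dj)) ≡ true → LK m B (suc di) (suc dj) ≡ true
    from e with di′ , dj′ , i≡ , j≡ , lkPair _ _ nri nlj balanced ← LK-true⁻ n A _ _ e
      with refl ← suc-injective (trans (sym o+1+di≡) i≡) | refl ← suc-injective j≡ =
      LK-true⁺ (lkPair di<m dj<m (trans nonRight≡ nri) (trans nonLeft≡ nlj)
                       (+-cancelˡ-≡ (#nonLeft o) _ _ (begin
                         #nonLeft o + count (nonRight m B) 1 di ≡⟨ #nonRight-window di di<m ⟨
                         #nonRight (o + di)                    ≡⟨ balanced ⟩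
                         #nonLeft (o + suc dj)                 ≡⟨ #nonLeft-window dj dj<m ⟩
                         #nonLeft o + count (nonLeft m B) 1 dj  ∎)))
      where open ≡-Reasoning

-- The induction on n

LK⊆ : ∀ {n A i j} → IsAntichain n A → LK n A i j ≡ true → InPoset n i j
LK⊆ {n} {A} {i} {j} anti e with _ , _ , refl , refl , lkPair _ dj<n _ _ _ ← LK-true⁻ n A i j e =
  s≤s z≤n , LKFacts.LK-ordered anti e , dj<n

coveredRun : ∀ {n A} → Within n A → ∀ {i j} → 1 ≤ i → i < j → j ≤ n → (∀ z → i ≤ z → z ≤ j → Below A z z) →
             ∃[ o ] ∃[ m ] (CoveredRun n A o (suc m) × o < i × j ≤ suc (o + suc m))
coveredRun {n} {A} A⊆ {suc i′} {j} _ i<j j≤n coveredIJ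
  with o , o≤i′ , leftGap , coveredLeft ← lastGap (λ x → below? A⊆ x x) i′
  with d , j+d≡n ← m≤n⇒∃[o]m+o≡n j≤n
  with b , j≤b , b≤j+d , rightGap , coveredRight ← firstGap (λ x → below? A⊆ x x) d j
  with m , refl ← m≤n⇒∃[o]m+o≡n (≤-trans (s≤s (s≤s o≤i′)) (≤-trans i<j j≤b))
  = o , m , run , s≤s o≤i′ , subst (j ≤_) b≡ j≤b
  where
  b≡ : suc (suc o) + m ≡ suc (o + suc m)
  b≡ = cong suc (sym (+-suc o m))
  b≤n : suc (suc o) + m ≤ n
  b≤n = subst (_ ≤_) j+d≡n b≤j+d
  run : CoveredRun n A o (suc m)
  run = record
    { fits     = subst (_≤ n) b≡ b≤n
    ; leftGap  = leftGap
    ; rightGap = λ b<n → subst (λ x → ¬ Below A (suc x) (suc x)) b≡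
                   (rightGap (subst (_< j + d) (sym b≡) (subst (suc (o + suc m) <_) (sym j+d≡n) b<n)))
    ; covered  = λ x o<x x≤b → case x ≤? i′ of λ where
        (yes x≤i′) → coveredLeft x o<x x≤i′
        (no x≰i′)  → case x ≤? j of λ where
          (yes x≤j) → coveredIJ x (≰⇒> x≰i′) x≤j
          (no x≰j)  → coveredRight x (≰⇒> x≰j) (subst (x ≤_) (sym b≡) x≤b)
    }

CoveredRun-small : ∀ {r A o m} → CoveredRun (suc r) A o (suc m) → suc m ≤ r
CoveredRun-small {o = o} {m} run = ≤-pred (≤-trans (s≤s (m≤n+m (suc m) o)) (CoveredRun.fits run))

module Cases {r A} (anti : IsAntichain (suc r) A) where
  private
    n = suc r
    A⊆ = proj₁ anti
    F = rvac n A
    F-antichain : IsAntichain n F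
    F-antichain = rvacAux-antichain n 1 r _ (upFrom-antichain n 0 n A anti)
    F-diagonal : ∀ x → F x x ≡ rowmotion n A x x
    F-diagonal x = rvacAux-diagonal n 1 r (rowmotion n A) x (s≤s z≤n)
  open LKFacts anti

  outside : ∀ {i j} → ¬ InPoset n i j → LK n A i j ≡ F i j
  outside ij∉ = trans (≢true⇒≡false (ij∉ ∘ LK⊆ anti)) (sym (≢true⇒≡false (ij∉ ∘ proj₁ F-antichain _ _)))

  diagonal : ∀ {x} → InPoset n x x → LK n A x x ≡ F x x
  diagonal {x} x∈@(1≤x , _ , x≤n) = bool-ext
    (λ e → trans (F-diagonal x) (rowmotion⁺ A⊆ (x∈ , LK-diagonal⁻ e , inj₁ refl)))
    (λ e → LK-diagonal⁺ 1≤x x≤n (proj₁ (proj₂ (rowmotion⁻ A⊆ (trans (sym (F-diagonal x)) e)))))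

  gap : ∀ {i j z} → InPoset n i j → i < j → i ≤ z → z ≤ j → ¬ Below A z z → LK n A i j ≡ F i j
  gap {i} {j} {z} (1≤i , _ , j≤n) i<j i≤z z≤j ¬b = trans
    (≢true⇒≡false λ e → ¬b (LK-covers e i<j i≤z z≤j))
    (sym (≢true⇒≡false λ e → let z≡i , z≡j = proj₂ F-antichain z z i j Fzz e i≤z z≤j
                              in <-irrefl (trans (sym z≡i) z≡j) i<j))
    where
    Fzz : F z z ≡ true
    Fzz = trans (F-diagonal z) (rowmotion⁺ A⊆ ((≤-trans 1≤i i≤z , ≤-refl , ≤-trans z≤j j≤n) , ¬b , inj₁ refl))

  inWindow : ∀ {o m i j} → CoveredRun n A o (suc m) →
             (∀ B → IsAntichain (suc m) B → ∀ i j → LK (suc m) B i j ≡ rvac (suc m) B i j) →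
             o < i → i < j → j ≤ suc (o + suc m) → LK n A i j ≡ F i j
  inWindow {o} {m} run lk≡rvac o<i i<j j≤b with m≤n⇒∃[o]m+o≡n (<⇒≤ o<i) | m≤n⇒∃[o]m+o≡n (<-trans o<i i<j)
  ... | zero , refl | _ = ⊥-elim (<-irrefl (sym (+-identityʳ o)) o<i)
  ... | suc di , refl | zero , refl with () ← +-cancelˡ-≤ o (suc di) 0 (≤-pred i<j)
  ... | suc di , refl | suc dj , refl = begin
    LK n A (o + suc di) (suc (o + suc dj))  ≡⟨ window-LK (≤-<-trans di≤dj dj<m) dj<m ⟨
    LK (suc m) B (suc di) (suc dj)          ≡⟨ lk≡rvac B B-antichain (suc di) (suc dj) ⟩
    rvac (suc m) B (suc di) (suc dj)        ≡⟨ rvac-window A rowmotion-WindowInv (CoveredRun-small run) (suc di) (suc dj) ⟨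
    window (suc m) o F (suc di) (suc dj)    ≡⟨ window-inside (suc m) o F (s≤s z≤n , s≤s di≤dj , dj<m) ⟩
    F (o + suc di) (suc (o + suc dj))       ∎
    where
    open ≡-Reasoning
    open CoveredWindow anti run
    B = window (suc m) o (rowmotion n A)
    di≤dj : di ≤ dj
    di≤dj = ≤-pred (+-cancelˡ-≤ o _ _ (≤-pred i<j))
    dj<m : suc dj ≤ suc m
    dj<m = +-cancelˡ-≤ o _ _ (≤-pred j≤b)

LK≡rvac : ∀ n → 1 ≤ n → ∀ A → IsAntichain n A → ∀ i j → LK n A i j ≡ rvac n A i j
LK≡rvac = <-rec _ step
  where
  step : ∀ n → (∀ {m} → m < n → 1 ≤ m → ∀ A → IsAntichain m A → ∀ i j → LK m A i j ≡ rvac m A i j) →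
         1 ≤ n → ∀ A → IsAntichain n A → ∀ i j → LK n A i j ≡ rvac n A i j
  step (suc r) smaller _ A anti i j with inPoset? (suc r) i j
  ... | no ij∉ = Cases.outside anti ij∉
  ... | yes ij∈@(1≤i , i≤j , j≤n) with i ≟ j
  ...   | yes refl = Cases.diagonal anti ij∈
  ...   | no i≢j with d , refl ← m≤n⇒∃[o]m+o≡n i≤j
    with allOrCounterexample (λ z → below? (proj₁ anti) z z) i (suc d)
  ...     | inj₂ (z , i≤z , z<end , ¬b) =
    Cases.gap anti ij∈ (≤∧≢⇒< i≤j i≢j) i≤z (≤-pred (subst (z <_) (+-suc i d) z<end)) ¬b
  ...     | inj₁ allCovered
    with o , m , run , o<i , j≤b ← coveredRun (proj₁ anti) 1≤i (≤∧≢⇒< i≤j i≢j) j≤n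
                                      (λ z i≤z z≤j → allCovered z i≤z (subst (z <_) (sym (+-suc i d)) (s≤s z≤j)))
    = Cases.inWindow anti run (smaller (s≤s (CoveredRun-small run)) (s≤s z≤n)) o<i (≤∧≢⇒< i≤j i≢j) j≤b

theorem3p5 : (n : ℕ) → 1 ≤ n → (A : IntSet) → IsAntichain n A →
    (i j : ℕ) → LK n A i j ≡ rvac n A i j
theorem3p5 = LK≡rvac
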